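{- Let $p\ge 5$ be a prime and $n$ a positive integer. Then $a_1(pn)\equiv 0\pmod{p^2}$, where $$a_1(N)=\sum_{k=0}^{\lfloor (N-1)/3\rfloor}(-1)^{N-k}\binom{3k+1}{k}\binom{2k+1}{k}\binom{N}{3k+1}\binom{N+k}{k}3^{N-3k-1}.$$ -}

module Defs where

open import Data.Nat using (ℕ; zero; suc; _∸_; _/_)
import Data.Nat as ℕ
open import Data.Nat.Combinatorics using (_C_)
open import Data.Integer using (ℤ; +_; -_; _+_; _*_)
open import Data.List using (List; map; upTo)
open import Data.List using () renaming (foldr to lfoldr)

sign : ℕ → ℤ
sign zero = + 1
sign (suc m) = - sign m

sumℤ : List ℤ → ℤ
sumℤ = lfoldr _+_ (+ 0)

term : ℕ → ℕ → ℤ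
term N k = sign (N ∸ k) * + ((((3 ℕ.* k ℕ.+ 1) C k) ℕ.* ((2 ℕ.* k ℕ.+ 1) C k))
             ℕ.* ((N C (3 ℕ.* k ℕ.+ 1)) ℕ.* ((N ℕ.+ k) C k))
             ℕ.* (3 ℕ.^ (N ∸ (3 ℕ.* k ℕ.+ 1))))

-- a₁(N) = Σ_{k=0}^{⌊(N-1)/3⌋} term N k ;
-- the indices 0 ≤ k ≤ ⌊(N-1)/3⌋ are exactly k < ⌊(N+2)/3⌋ (empty for N = 0).
a₁ : ℕ → ℤ
a₁ N = sumℤ (map (term N) (upTo ((N ℕ.+ 2) / 3)))

module Submission where

-- Put N = pn.  Absorption identities turn every summand of a₁(N) into N·reduced(k),
-- where reduced(k) = ±Cat(k)·C(3k,k)·C(N-1,3k)·C(N+k,k)·3^(N-3k-1) and Cat(k) is the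
-- Catalan number; since p ∣ N it suffices that Σₖ reduced(k) ≡ 0 (mod p).  Writing
-- k = s·p + t with t < p, Lucas' theorem factors reduced(s·p + t) ≡ high(s)·low(t),
-- where low(t) vanishes unless 3t < p (otherwise a carry kills C(3k,k) or Cat(k)).
-- Hence the whole sum is (Σₛ high(s))·(Σ_{t<p} low(t)), and it remains to show that
-- the central sum Σ_{t<p} low(t) ≡ 0.  With m = ⌊p/3⌋ and a = p-1-m, the trinomial
-- C(3t,t)·C(2t,t) is ≡ 27^t·C(a,t)·C(m,t) for t ≤ m (both satisfy the same first-order
-- recurrence mod p), which turns (m+1)·Σ low(t) into 3^(p-1)·Σₜ C(a,t)·C(m+1,m-t)
-- = 3^(p-1)·C(p,m) ≡ 0 by Vandermonde's identity.

open import Function using (_∘_; id)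
open import Relation.Binary.PropositionalEquality
open import Relation.Nullary using (yes; no; ¬_; Dec)
import Relation.Binary.Reasoning.Setoid
open import Data.Empty using (⊥-elim)
open import Data.Sum using (_⊎_; inj₁; inj₂)
open import Data.Product using (Σ; _,_; _×_)
open import Data.List using (map; upTo; applyUpTo)
open import Data.Nat as ℕ using (ℕ; zero; suc; _∸_; _<_; _≤_; s≤s; z≤n)
import Data.Nat.Properties as ℕP
open import Data.Nat.DivMod using (_%_; _/_; m%n<n; m≡m%n+[m/n]*n; m/n*n≤m)
import Data.Nat.Divisibility as ℕD
open import Data.Nat.Primality using (Prime; euclidsLemma; prime⇒¬composite; composite)
import Data.Nat.Tactic.RingSolver as ℕSolver
open import Data.Integer as Z using (ℤ; +_; 0ℤ)
import Data.Integer.Properties as ZP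
open import Data.Integer.Tactic.RingSolver using (solve-∀)
open import Defs using (sign; sumℤ; term; a₁)

module Sums where
  open Z using (_+_; _*_)

  Σ< : ℕ → (ℕ → ℤ) → ℤ
  Σ< zero    f = 0ℤ
  Σ< (suc n) f = f 0 + Σ< n (f ∘ suc)

  sumℤ-upTo : ∀ (g : ℕ → ℤ) n → sumℤ (map g (upTo n)) ≡ Σ< n g
  sumℤ-upTo g n = go n id
    where
    go : ∀ n h → sumℤ (map g (applyUpTo h n)) ≡ Σ< n (g ∘ h)
    go zero    h = refl
    go (suc n) h = cong (_+_ (g (h 0))) (go n (h ∘ suc))

  Σ<-cong : ∀ n {f g} → (∀ j → f j ≡ g j) → Σ< n f ≡ Σ< n g
  Σ<-cong zero    e = refl
  Σ<-cong (suc n) e = cong₂ _+_ (e 0) (Σ<-cong n (e ∘ suc))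

  Σ<-zero : ∀ n {f} → (∀ j → f j ≡ 0ℤ) → Σ< n f ≡ 0ℤ
  Σ<-zero zero    e = refl
  Σ<-zero (suc n) e = cong₂ _+_ (e 0) (Σ<-zero n (e ∘ suc))

  Σ<-+ : ∀ n f g → Σ< n (λ j → f j + g j) ≡ Σ< n f + Σ< n g
  Σ<-+ zero    f g = refl
  Σ<-+ (suc n) f g = trans (cong (_+_ (f 0 + g 0)) (Σ<-+ n (f ∘ suc) (g ∘ suc)))
                            (interchange (f 0) (g 0) (Σ< n (f ∘ suc)) (Σ< n (g ∘ suc)))
    where
    interchange : ∀ a b c d → (a + b) + (c + d) ≡ (a + c) + (b + d)
    interchange = solve-∀

  Σ<-*ˡ : ∀ n c f → Σ< n (λ j → c * f j) ≡ c * Σ< n f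
  Σ<-*ˡ zero    c f = sym (ZP.*-zeroʳ c)
  Σ<-*ˡ (suc n) c f = trans (cong (_+_ (c * f 0)) (Σ<-*ˡ n c (f ∘ suc))) (sym (ZP.*-distribˡ-+ c (f 0) _))

  Σ<-split : ∀ a b f → Σ< (a ℕ.+ b) f ≡ Σ< a f + Σ< b (λ j → f (a ℕ.+ j))
  Σ<-split zero    b f = sym (ZP.+-identityˡ _)
  Σ<-split (suc a) b f = trans (cong (_+_ (f 0)) (Σ<-split a b (f ∘ suc))) (sym (ZP.+-assoc (f 0) _ _))

  Σ<-extend : ∀ a b f → (∀ j → f (a ℕ.+ j) ≡ 0ℤ) → Σ< (a ℕ.+ b) f ≡ Σ< a f
  Σ<-extend a b f e = trans (Σ<-split a b f) (trans (cong (_+_ (Σ< a f)) (Σ<-zero b e)) (ZP.+-identityʳ _))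

  Σ<-blocks : ∀ m p f → Σ< (m ℕ.* p) f ≡ Σ< m (λ s → Σ< p (λ t → f (s ℕ.* p ℕ.+ t)))
  Σ<-blocks zero    p f = refl
  Σ<-blocks (suc m) p f = trans (Σ<-split p (m ℕ.* p) f)
    (cong (_+_ (Σ< p f)) (trans (Σ<-blocks m p (λ j → f (p ℕ.+ j)))
      (Σ<-cong m (λ s → Σ<-cong p (λ t → cong f (sym (ℕP.+-assoc p (s ℕ.* p) t)))))))

module Signs where
  open Z using (_*_; -_)

  sign-+ : ∀ a b → sign (a ℕ.+ b) ≡ sign a * sign b
  sign-+ zero    b = sym (ZP.*-identityˡ (sign b))
  sign-+ (suc a) b = trans (cong -_ (sign-+ a b)) (ZP.neg-distribˡ-* (sign a) (sign b))

  sign-square : ∀ a → sign a * sign a ≡ + 1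
  sign-square zero    = refl
  sign-square (suc a) = trans (neg-square (sign a)) (sign-square a)
    where neg-square : ∀ x → - x * - x ≡ x * x
          neg-square = solve-∀

  sign-∸ : ∀ a b → b ≤ a → sign (a ∸ b) ≡ sign a * sign b
  sign-∸ a b b≤a = begin
    sign (a ∸ b)                          ≡⟨ ZP.*-identityʳ (sign (a ∸ b)) ⟨
    sign (a ∸ b) * + 1                    ≡⟨ cong (sign (a ∸ b) *_) (sign-square b) ⟨
    sign (a ∸ b) * (sign b * sign b)      ≡⟨ ZP.*-assoc (sign (a ∸ b)) (sign b) (sign b) ⟨
    sign (a ∸ b) * sign b * sign b        ≡⟨ cong (_* sign b) (sign-+ (a ∸ b) b) ⟨
    sign (a ∸ b ℕ.+ b) * sign b           ≡⟨ cong (λ x → sign x * sign b) (ℕP.m∸n+n≡m b≤a) ⟩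
    sign a * sign b                       ∎
    where open ≡-Reasoning

  sign-*odd : ∀ d e → sign (d ℕ.* suc (2 ℕ.* e)) ≡ sign d
  sign-*odd d e = begin
    sign (d ℕ.* suc (2 ℕ.* e))            ≡⟨ cong sign (expand d e) ⟩
    sign (d ℕ.+ (d ℕ.* e ℕ.+ d ℕ.* e))    ≡⟨ sign-+ d _ ⟩
    sign d * sign (d ℕ.* e ℕ.+ d ℕ.* e)   ≡⟨ cong (sign d *_) (trans (sign-+ (d ℕ.* e) (d ℕ.* e)) (sign-square (d ℕ.* e))) ⟩
    sign d * + 1                          ≡⟨ ZP.*-identityʳ (sign d) ⟩
    sign d                                ∎
    where
    open ≡-Reasoning
    expand : ∀ d e → d ℕ.* suc (2 ℕ.* e) ≡ d ℕ.+ (d ℕ.* e ℕ.+ d ℕ.* e)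
    expand = ℕSolver.solve-∀

  sign-3* : ∀ t → sign t * sign (3 ℕ.* t) ≡ + 1
  sign-3* t = begin
    sign t * sign (3 ℕ.* t)   ≡⟨ cong (λ x → sign t * sign x) (ℕP.*-comm 3 t) ⟩
    sign t * sign (t ℕ.* 3)   ≡⟨ cong (sign t *_) (sign-*odd t 1) ⟩
    sign t * sign t           ≡⟨ sign-square t ⟩
    + 1                       ∎
    where open ≡-Reasoning

module Binomial where
  open import Data.Nat using (_+_; _*_)
  open Sums
  open import Data.Nat.Combinatorics using (_C_; nCk+nC[k+1]≡[n+1]C[k+1]; nCk≡nC[n∸k])

  -- Binomial coefficients given by Pascal's rule.  They agree with the library's
  -- n C k (B≡C), and the defining equations make induction on n immediate.
  B : ℕ → ℕ → ℕ
  B _       zero    = 1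
  B zero    (suc k) = 0
  B (suc n) (suc k) = B n k + B n (suc k)

  B≡C : ∀ n k → B n k ≡ n C k
  B≡C n       zero    = refl
  B≡C zero    (suc k) = refl
  B≡C (suc n) (suc k) = trans (cong₂ _+_ (B≡C n k) (B≡C n (suc k))) (nCk+nC[k+1]≡[n+1]C[k+1] n k)

  B-above : ∀ n k → n < k → B n k ≡ 0
  B-above zero    (suc k) _           = refl
  B-above (suc n) (suc k) (s≤s n<k) = cong₂ _+_ (B-above n k n<k) (B-above n (suc k) (ℕP.m<n⇒m<1+n n<k))

  B-diag : ∀ n → B n n ≡ 1
  B-diag zero    = refl
  B-diag (suc n) = cong₂ _+_ (B-diag n) (B-above n (suc n) (ℕP.n<1+n n))

  B-sym : ∀ n k → k ≤ n → B n k ≡ B n (n ∸ k)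
  B-sym n k k≤n = trans (B≡C n k) (trans (nCk≡nC[n∸k] k≤n) (sym (B≡C n (n ∸ k))))

  absorption : ∀ n j → suc j * B (suc n) (suc j) ≡ suc n * B n j
  absorption n zero = trans (ℕP.+-identityʳ (B (suc n) 1)) (trans (B-one (suc n)) (sym (ℕP.*-identityʳ (suc n))))
    where
    B-one : ∀ n → B n 1 ≡ n
    B-one zero    = refl
    B-one (suc n) = cong suc (B-one n)
  absorption zero    (suc j) = ℕP.*-zeroʳ (suc (suc j))
  absorption (suc n) (suc j) = begin
    (2 + j) * (x + y)                  ≡⟨ regroup j x y ⟩
    ((1 + j) * x + x) + (2 + j) * y    ≡⟨ cong₂ (λ u v → (u + x) + v) (absorption n j) (absorption n (suc j)) ⟩
    ((1 + n) * u + x) + (1 + n) * v    ≡⟨ collect n u v x ⟩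
    (1 + n) * (u + v) + x              ≡⟨ ℕP.+-comm ((1 + n) * x) x ⟩
    (2 + n) * x                        ∎
    where
    open ≡-Reasoning
    x = B (suc n) (suc j)
    y = B (suc n) (suc (suc j))
    u = B n j
    v = B n (suc j)
    regroup : ∀ j x y → (2 + j) * (x + y) ≡ ((1 + j) * x + x) + (2 + j) * y
    regroup = ℕSolver.solve-∀
    collect : ∀ n u v x → ((1 + n) * u + x) + (1 + n) * v ≡ (1 + n) * (u + v) + x
    collect = ℕSolver.solve-∀

  absorption-∸ : ∀ n j → suc j * B n (suc j) ≡ (n ∸ j) * B n j
  absorption-∸ n j with j ℕ.≤? n
  ... | no j≰n = begin
    suc j * B n (suc j)  ≡⟨ cong (suc j *_) (B-above n (suc j) (ℕP.m<n⇒m<1+n (ℕP.≰⇒> j≰n))) ⟩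
    suc j * 0            ≡⟨ ℕP.*-zeroʳ (suc j) ⟩
    0                    ≡⟨ ℕP.*-zeroʳ (n ∸ j) ⟨
    (n ∸ j) * 0          ≡⟨ cong ((n ∸ j) *_) (B-above n j (ℕP.≰⇒> j≰n)) ⟨
    (n ∸ j) * B n j      ∎
    where open ≡-Reasoning
  ... | yes j≤n = ℕP.+-cancelˡ-≡ (suc j * B n j) _ _ (begin
    suc j * B n j + suc j * B n (suc j)  ≡⟨ ℕP.*-distribˡ-+ (suc j) (B n j) (B n (suc j)) ⟨
    suc j * B (suc n) (suc j)            ≡⟨ absorption n j ⟩
    suc n * B n j                        ≡⟨ cong (λ m → suc m * B n j) (ℕP.m+[n∸m]≡n j≤n) ⟨
    (suc j + (n ∸ j)) * B n j            ≡⟨ ℕP.*-distribʳ-+ (B n j) (suc j) (n ∸ j) ⟩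
    suc j * B n j + (n ∸ j) * B n j      ∎)
    where open ≡-Reasoning

  absorption-row : ∀ n j → (suc n ∸ j) * B (suc n) j ≡ suc n * B n j
  absorption-row n j = trans (sym (absorption-∸ (suc n) j)) (absorption n j)

  pascalℤ : ∀ n k → + B (suc n) (suc k) ≡ + B n k Z.+ + B n (suc k)
  pascalℤ n k = ZP.pos-+ (B n k) (B n (suc k))

  vandermonde : ∀ a b r → Σ< (suc r) (λ j → + B a j Z.* + B b (r ∸ j)) ≡ + B (a + b) r
  vandermonde zero b r = begin
    + 1 Z.* + B b r Z.+ Σ< r (λ j → + 0 Z.* + B b (r ∸ suc j))  ≡⟨ cong₂ Z._+_ (ZP.*-identityˡ (+ B b r)) (Σ<-zero r (λ j → ZP.*-zeroˡ (+ B b (r ∸ suc j)))) ⟩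
    + B b r Z.+ 0ℤ                                                ≡⟨ ZP.+-identityʳ (+ B b r) ⟩
    + B b r                                                       ∎
    where open ≡-Reasoning
  vandermonde (suc a) b zero    = refl
  vandermonde (suc a) b (suc r) = begin
    lead Z.+ Σ< (suc r) (λ j → + B (suc a) (suc j) Z.* c j)
      ≡⟨ cong (Z._+_ lead) (Σ<-cong (suc r) (λ j → trans (cong (Z._* c j) (pascalℤ a j)) (ZP.*-distribʳ-+ (c j) (+ B a j) (+ B a (suc j))))) ⟩
    lead Z.+ Σ< (suc r) (λ j → + B a j Z.* c j Z.+ + B a (suc j) Z.* c j)
      ≡⟨ cong (Z._+_ lead) (Σ<-+ (suc r) (λ j → + B a j Z.* c j) (λ j → + B a (suc j) Z.* c j)) ⟩
    lead Z.+ (Σ< (suc r) (λ j → + B a j Z.* c j) Z.+ Σ< (suc r) (λ j → + B a (suc j) Z.* c j))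
      ≡⟨ swap lead (Σ< (suc r) (λ j → + B a j Z.* c j)) (Σ< (suc r) (λ j → + B a (suc j) Z.* c j)) ⟩
    Σ< (suc r) (λ j → + B a j Z.* c j) Z.+ Σ< (suc (suc r)) (λ j → + B a j Z.* + B b (suc r ∸ j))
      ≡⟨ cong₂ Z._+_ (vandermonde a b r) (vandermonde a b (suc r)) ⟩
    + B (a + b) r Z.+ + B (a + b) (suc r)
      ≡⟨ pascalℤ (a + b) r ⟨
    + B (suc a + b) (suc r) ∎
    where
    open ≡-Reasoning
    c : ℕ → ℤ
    c j = + B b (r ∸ j)
    lead : ℤ
    lead = + 1 Z.* + B b (suc r)
    swap : ∀ x y z → x Z.+ (y Z.+ z) ≡ y Z.+ (x Z.+ z)
    swap = solve-∀

-- Congruence modulo an integer P, packaged as a setoid so that equational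
-- reasoning is available for chains of congruences.
module Congruence (P : ℤ) where
  open Z using (_+_; _-_; _*_; -_)
  open import Data.Integer.Divisibility.Signed using (_∣_; divides; ∣m∣n⇒∣m+n; ∣m⇒∣-m; ∣n⇒∣m*n; ∣m⇒∣m*n)
  open import Relation.Binary.Bundles using (Setoid)
  open Sums using (Σ<)

  infix 4 _≈_
  record _≈_ (x y : ℤ) : Set where
    constructor mk
    field divides-difference : P ∣ (x - y)
  open _≈_ public

  private
    along : ∀ {a b} → a ≡ b → P ∣ a → P ∣ b
    along refl d = d

  ≈-reflexive : ∀ {x y} → x ≡ y → x ≈ y
  ≈-reflexive {x} refl = mk (divides 0ℤ (trans (ZP.+-inverseʳ x) (sym (ZP.*-zeroˡ P))))

  ≈-refl : ∀ {x} → x ≈ x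
  ≈-refl = ≈-reflexive refl

  ≈-sym : ∀ {x y} → x ≈ y → y ≈ x
  ≈-sym {x} {y} (mk d) = mk (along (negate x y) (∣m⇒∣-m d))
    where negate : ∀ x y → - (x - y) ≡ y - x
          negate = solve-∀

  ≈-trans : ∀ {x y z} → x ≈ y → y ≈ z → x ≈ z
  ≈-trans {x} {y} {z} (mk d) (mk e) = mk (along (telescope x y z) (∣m∣n⇒∣m+n d e))
    where telescope : ∀ x y z → (x - y) + (y - z) ≡ x - z
          telescope = solve-∀

  ≈-setoid : Setoid _ _
  ≈-setoid = record { Carrier = ℤ ; _≈_ = _≈_
                    ; isEquivalence = record { refl = ≈-refl ; sym = ≈-sym ; trans = ≈-trans } }

  module ≈-Reasoning = Relation.Binary.Reasoning.Setoid ≈-setoid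

  multiple≈0 : ∀ {x} → P ∣ x → x ≈ 0ℤ
  multiple≈0 {x} d = mk (along (sym (ZP.+-identityʳ x)) d)

  +-cong : ∀ {x y u v} → x ≈ y → u ≈ v → x + u ≈ y + v
  +-cong {x} {y} {u} {v} (mk d) (mk e) = mk (along (regroup x y u v) (∣m∣n⇒∣m+n d e))
    where regroup : ∀ x y u v → (x - y) + (u - v) ≡ (x + u) - (y + v)
          regroup = solve-∀

  neg-cong : ∀ {x y} → x ≈ y → - x ≈ - y
  neg-cong {x} {y} (mk d) = mk (along (regroup x y) (∣m⇒∣-m d))
    where regroup : ∀ x y → - (x - y) ≡ - x - - y
          regroup = solve-∀

  *-cong : ∀ {x y u v} → x ≈ y → u ≈ v → x * u ≈ y * v
  *-cong {x} {y} {u} {v} (mk d) (mk e) = mk (along (regroup x y u v) (∣m∣n⇒∣m+n (∣n⇒∣m*n x e) (∣m⇒∣m*n v d)))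
    where regroup : ∀ x y u v → x * (u - v) + (x - y) * v ≡ x * u - y * v
          regroup = solve-∀

  *-congˡ : ∀ c {u v} → u ≈ v → c * u ≈ c * v
  *-congˡ c = *-cong (≈-refl {c})

  *-congʳ : ∀ c {u v} → u ≈ v → u * c ≈ v * c
  *-congʳ c e = *-cong e (≈-refl {c})

  Σ<-≈< : ∀ n {f g} → (∀ j → j < n → f j ≈ g j) → Σ< n f ≈ Σ< n g
  Σ<-≈< zero    e = ≈-refl
  Σ<-≈< (suc n) e = +-cong (e 0 (s≤s z≤n)) (Σ<-≈< n (λ j j<n → e (suc j) (s≤s j<n)))

  Σ<-≈ : ∀ n {f g} → (∀ j → f j ≈ g j) → Σ< n f ≈ Σ< n g
  Σ<-≈ n e = Σ<-≈< n (λ j _ → e j)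

module ModPrime (p : ℕ) (isPrime : Prime p) where
  open Congruence (+ p) public
  open Z using (_+_; _-_; _*_)
  open import Data.Integer.Divisibility.Signed using (divides; ∣ᵤ⇒∣; ∣⇒∣ᵤ)

  unit : ∀ u → 0 < u → u < p → ¬ (p ℕD.∣ u)
  unit (suc u) _ u<p p∣u = ℕP.<⇒≱ u<p (ℕD.∣⇒≤ p∣u)

  cancel : ∀ u {x y} → ¬ (p ℕD.∣ u) → + u * x ≈ + u * y → x ≈ y
  cancel u {x} {y} p∤u (mk d) with euclidsLemma u Z.∣ x - y ∣ isPrime (subst (p ℕD.∣_) ∣u[x-y]∣ (∣⇒∣ᵤ d))
    where
    factor : ∀ u x y → u * x - u * y ≡ u * (x - y)
    factor = solve-∀
    ∣u[x-y]∣ : Z.∣ + u * x - + u * y ∣ ≡ u ℕ.* Z.∣ x - y ∣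
    ∣u[x-y]∣ = trans (cong Z.∣_∣ (factor (+ u) x y)) (ZP.abs-* (+ u) (x - y))
  ... | inj₁ p∣u = ⊥-elim (p∤u p∣u)
  ... | inj₂ p∣x-y = mk (∣ᵤ⇒∣ p∣x-y)

  ≈-fromℕ : ∀ x y c d → x ℕ.+ c ℕ.* p ≡ y ℕ.+ d ℕ.* p → + x ≈ + y
  ≈-fromℕ x y c d e = mk (divides (+ d - + c) (difference (+ x) (+ y) (+ c) (+ d) (+ p) eℤ))
    where
    eℤ : + x + + c * + p ≡ + y + + d * + p
    eℤ = begin
      + x + + c * + p     ≡⟨ cong (_+_ (+ x)) (ZP.pos-* c p) ⟨
      + x + + (c ℕ.* p)   ≡⟨ ZP.pos-+ x (c ℕ.* p) ⟨
      + (x ℕ.+ c ℕ.* p)   ≡⟨ cong +_ e ⟩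
      + (y ℕ.+ d ℕ.* p)   ≡⟨ ZP.pos-+ y (d ℕ.* p) ⟩
      + y + + (d ℕ.* p)   ≡⟨ cong (_+_ (+ y)) (ZP.pos-* d p) ⟩
      + y + + d * + p     ∎
      where open ≡-Reasoning
    difference : ∀ x y c d p → x + c * p ≡ y + d * p → x - y ≡ (d - c) * p
    difference x y c d p h = trans (shift x y c p) (trans (cong (_- (y + c * p)) h) (cancel-y y c d p))
      where
      shift : ∀ x y c p → x - y ≡ (x + c * p) - (y + c * p)
      shift = solve-∀
      cancel-y : ∀ y c d p → (y + d * p) - (y + c * p) ≡ (d - c) * p
      cancel-y = solve-∀

  *-congℕ : ∀ {x x′ y y′} → + x ≈ + x′ → + y ≈ + y′ → + (x ℕ.* y) ≈ + (x′ ℕ.* y′)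
  *-congℕ {x} {x′} {y} {y′} e f =
    ≈-trans (≈-reflexive (ZP.pos-* x y)) (≈-trans (*-cong e f) (≈-reflexive (sym (ZP.pos-* x′ y′))))

  cancelℕ : ∀ c {x y} → 0 < c → c < p → + (c ℕ.* x) ≈ + (c ℕ.* y) → + x ≈ + y
  cancelℕ c {x} {y} 0<c c<p e =
    cancel c (unit c 0<c c<p) (≈-trans (≈-reflexive (sym (ZP.pos-* c x))) (≈-trans e (≈-reflexive (ZP.pos-* c y))))

module Lucas (q : ℕ) (isPrime : Prime (suc q)) where
  open Z using (_+_; _-_; _*_; -_)
  open Binomial
  open import Data.Integer.Divisibility.Signed using (∣ᵤ⇒∣)

  p : ℕ
  p = suc q

  open ModPrime p isPrime public
  open ≈-Reasoning

  -- p ∣ C(p, j) for 0 < j < p, since j·C(p, j) = p·C(p-1, j-1).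
  B-prime≈0 : ∀ j → 0 < j → j < p → + B p j ≈ 0ℤ
  B-prime≈0 (suc j) 0<j j<p with euclidsLemma (suc j) (B p (suc j)) isPrime (ℕD.divides (B q j) (trans (absorption q j) (ℕP.*-comm p (B q j))))
  ... | inj₁ p∣j = ⊥-elim (unit (suc j) 0<j j<p p∣j)
  ... | inj₂ p∣C = multiple≈0 (∣ᵤ⇒∣ p∣C)

  B-shift-low : ∀ n j → j < p → + B (n ℕ.+ p) j ≈ + B n j
  B-shift-low zero    zero    _   = ≈-refl
  B-shift-low zero    (suc j) j<p = B-prime≈0 (suc j) (s≤s z≤n) j<p
  B-shift-low (suc n) zero    _   = ≈-refl
  B-shift-low (suc n) (suc j) j<p = begin
    + B (suc n ℕ.+ p) (suc j)                    ≡⟨ pascalℤ (n ℕ.+ p) j ⟩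
    + B (n ℕ.+ p) j + + B (n ℕ.+ p) (suc j)      ≈⟨ +-cong (B-shift-low n j (ℕP.<-trans (ℕP.n<1+n j) j<p)) (B-shift-low n (suc j) j<p) ⟩
    + B n j + + B n (suc j)                      ≡⟨ pascalℤ n j ⟨
    + B (suc n) (suc j)                          ∎

  B-shift-high : ∀ n j → + B (n ℕ.+ p) (p ℕ.+ j) ≈ + B n (p ℕ.+ j) + + B n j
  B-shift-high zero zero = begin
    + B p (p ℕ.+ 0)  ≡⟨ cong (λ x → + B p x) (ℕP.+-identityʳ p) ⟩
    + B p p          ≡⟨ cong +_ (B-diag p) ⟩
    + 1              ∎
  B-shift-high zero (suc j) = ≈-reflexive (cong +_ (B-above p (p ℕ.+ suc j) (ℕP.m<m+n p (s≤s z≤n))))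
  B-shift-high (suc n) j = begin
    + B (suc n ℕ.+ p) (p ℕ.+ j)                                      ≡⟨ pascalℤ (n ℕ.+ p) (q ℕ.+ j) ⟩
    + B (n ℕ.+ p) (q ℕ.+ j) + + B (n ℕ.+ p) (p ℕ.+ j)                ≈⟨ +-cong (lower j) (B-shift-high n j) ⟩
    (+ B n (q ℕ.+ j) + lower-rest j) + (+ B n (p ℕ.+ j) + + B n j)   ≡⟨ interchange (+ B n (q ℕ.+ j)) (lower-rest j) (+ B n (p ℕ.+ j)) (+ B n j) ⟩
    (+ B n (q ℕ.+ j) + + B n (p ℕ.+ j)) + (lower-rest j + + B n j)   ≡⟨ cong₂ _+_ (sym (pascalℤ n (q ℕ.+ j))) (upper j) ⟩
    + B (suc n) (p ℕ.+ j) + + B (suc n) j                            ∎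
    where
    interchange : ∀ a b c d → (a + b) + (c + d) ≡ (a + c) + (b + d)
    interchange = solve-∀
    -- [j > 0]·C(n, j-1): what `B-shift-high` adds to C(n, q+j) = C(n, p+(j-1))
    lower-rest : ℕ → ℤ
    lower-rest zero    = 0ℤ
    lower-rest (suc j) = + B n j
    lower : ∀ j → + B (n ℕ.+ p) (q ℕ.+ j) ≈ + B n (q ℕ.+ j) + lower-rest j
    lower zero    = ≈-trans (B-shift-low n (q ℕ.+ 0) (s≤s (ℕP.≤-reflexive (ℕP.+-identityʳ q)))) (≈-reflexive (sym (ZP.+-identityʳ _)))
    lower (suc j) = begin
      + B (n ℕ.+ p) (q ℕ.+ suc j)      ≡⟨ cong (λ x → + B (n ℕ.+ p) x) (ℕP.+-suc q j) ⟩
      + B (n ℕ.+ p) (p ℕ.+ j)          ≈⟨ B-shift-high n j ⟩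
      + B n (p ℕ.+ j) + + B n j        ≡⟨ cong (λ x → + B n x + + B n j) (ℕP.+-suc q j) ⟨
      + B n (q ℕ.+ suc j) + + B n j    ∎
    upper : ∀ j → lower-rest j + + B n j ≡ + B (suc n) j
    upper zero    = refl
    upper (suc j) = sym (pascalℤ n j)

  private
    next-digit : ∀ a b → suc a ℕ.* p ℕ.+ b ≡ (a ℕ.* p ℕ.+ b) ℕ.+ p
    next-digit a b = rearrange a b p
      where rearrange : ∀ a b p → p ℕ.+ a ℕ.* p ℕ.+ b ≡ (a ℕ.* p ℕ.+ b) ℕ.+ p
            rearrange = ℕSolver.solve-∀

  lucas : ∀ a b c d → b < p → d < p → + B (a ℕ.* p ℕ.+ b) (c ℕ.* p ℕ.+ d) ≈ + B a c * + B b d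
  lucas zero b zero d _ _ = ≈-reflexive (sym (ZP.*-identityˡ (+ B b d)))
  lucas zero b (suc c) d b<p _ = ≈-reflexive (trans (cong +_ (B-above b (suc c ℕ.* p ℕ.+ d) b<top)) (sym (ZP.*-zeroˡ (+ B b d))))
    where b<top = ℕP.<-≤-trans b<p (ℕP.≤-trans (ℕP.m≤m+n p (c ℕ.* p)) (ℕP.m≤m+n (suc c ℕ.* p) d))
  lucas (suc a) b zero d b<p d<p = begin
    + B (suc a ℕ.* p ℕ.+ b) d            ≡⟨ cong (λ x → + B x d) (next-digit a b) ⟩
    + B ((a ℕ.* p ℕ.+ b) ℕ.+ p) d        ≈⟨ B-shift-low (a ℕ.* p ℕ.+ b) d d<p ⟩
    + B (a ℕ.* p ℕ.+ b) (0 ℕ.* p ℕ.+ d)  ≈⟨ lucas a b 0 d b<p d<p ⟩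
    + 1 * + B b d                        ∎
  lucas (suc a) b (suc c) d b<p d<p = begin
    + B (suc a ℕ.* p ℕ.+ b) (suc c ℕ.* p ℕ.+ d)
      ≡⟨ cong₂ (λ x y → + B x y) (next-digit a b) (ℕP.+-assoc p (c ℕ.* p) d) ⟩
    + B ((a ℕ.* p ℕ.+ b) ℕ.+ p) (p ℕ.+ (c ℕ.* p ℕ.+ d))
      ≈⟨ B-shift-high (a ℕ.* p ℕ.+ b) (c ℕ.* p ℕ.+ d) ⟩
    + B (a ℕ.* p ℕ.+ b) (p ℕ.+ (c ℕ.* p ℕ.+ d)) + + B (a ℕ.* p ℕ.+ b) (c ℕ.* p ℕ.+ d)
      ≡⟨ cong (λ y → + B (a ℕ.* p ℕ.+ b) y + + B (a ℕ.* p ℕ.+ b) (c ℕ.* p ℕ.+ d)) (sym (ℕP.+-assoc p (c ℕ.* p) d)) ⟩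
    + B (a ℕ.* p ℕ.+ b) (suc c ℕ.* p ℕ.+ d) + + B (a ℕ.* p ℕ.+ b) (c ℕ.* p ℕ.+ d)
      ≈⟨ +-cong (lucas a b (suc c) d b<p d<p) (lucas a b c d b<p d<p) ⟩
    + B a (suc c) * + B b d + + B a c * + B b d
      ≡⟨ ZP.*-distribʳ-+ (+ B b d) (+ B a (suc c)) (+ B a c) ⟨
    (+ B a (suc c) + + B a c) * + B b d
      ≡⟨ cong (_* + B b d) (trans (ZP.+-comm (+ B a (suc c)) (+ B a c)) (sym (pascalℤ a c))) ⟩
    + B (suc a) (suc c) * + B b d ∎

  lucas-carry : ∀ a b c d → b < d → d < p → + B (a ℕ.* p ℕ.+ b) (c ℕ.* p ℕ.+ d) ≈ 0ℤ
  lucas-carry a b c d b<d d<p = begin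
    + B (a ℕ.* p ℕ.+ b) (c ℕ.* p ℕ.+ d)  ≈⟨ lucas a b c d (ℕP.<-trans b<d d<p) d<p ⟩
    + B a c * + B b d                    ≡⟨ cong (λ x → + B a c * + x) (B-above b d b<d) ⟩
    + B a c * 0ℤ                         ≡⟨ ZP.*-zeroʳ (+ B a c) ⟩
    0ℤ                                   ∎

  -- C(p-1, r) ≡ (-1)^r for r < p, from Pascal's rule and p ∣ C(p, r).
  B-pred≈sign : ∀ r → r < p → + B q r ≈ sign r
  B-pred≈sign zero    _   = ≈-refl
  B-pred≈sign (suc r) r<p = begin
    + B q (suc r)                        ≡⟨ add-sub (+ B q r) (+ B q (suc r)) ⟩
    (+ B q r + + B q (suc r)) - + B q r  ≡⟨ cong (_- + B q r) (pascalℤ q r) ⟨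
    + B p (suc r) - + B q r              ≈⟨ +-cong (B-prime≈0 (suc r) (s≤s z≤n) r<p) (neg-cong (B-pred≈sign r (ℕP.<-trans (ℕP.n<1+n r) r<p))) ⟩
    0ℤ - sign r                          ≡⟨ ZP.+-identityˡ (- sign r) ⟩
    sign (suc r)                         ∎
    where add-sub : ∀ a b → b ≡ (a + b) - a
          add-sub = solve-∀

module CentralBinomials where
  open import Data.Nat using (_+_; _*_)
  open Binomial

  -- Absorption with the indices given up to provable equality.
  diagonal-step : ∀ n′ n j′ j → n′ ≡ suc n → j′ ≡ suc j → j′ * B n′ j′ ≡ n′ * B n j
  diagonal-step _ n _ j refl refl = absorption n j

  row-step : ∀ n′ n j c d → n′ ≡ suc n → n ≡ j + d → c ≡ suc d → c * B n′ j ≡ n′ * B n j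
  row-step _ _ j _ d refl refl refl =
    trans (cong (_* B (suc (j + d)) j) (sym (trans (cong (_∸ j) (sym (ℕP.+-suc j d))) (ℕP.m+n∸m≡n j (suc d)))))
          (absorption-row (j + d) j)

  C3-lower : ∀ t → (2 * t + 1) * B (3 * t + 1) t ≡ (3 * t + 1) * B (3 * t) t
  C3-lower t = row-step (3 * t + 1) (3 * t) t (2 * t + 1) (2 * t) (top t) (split t) (coeff t)
    where
    top : ∀ t → 3 * t + 1 ≡ suc (3 * t)
    top = ℕSolver.solve-∀
    split : ∀ t → 3 * t ≡ t + 2 * t
    split = ℕSolver.solve-∀
    coeff : ∀ t → 2 * t + 1 ≡ suc (2 * t)
    coeff = ℕSolver.solve-∀

  C2-lower : ∀ t → (1 + t) * B (2 * t + 1) t ≡ (2 * t + 1) * B (2 * t) t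
  C2-lower t = row-step (2 * t + 1) (2 * t) t (1 + t) t (top t) (split t) refl
    where
    top : ∀ t → 2 * t + 1 ≡ suc (2 * t)
    top = ℕSolver.solve-∀
    split : ∀ t → 2 * t ≡ t + t
    split = ℕSolver.solve-∀

  C3-step : ∀ t → (1 + t) * ((2 * t + 2) * ((2 * t + 1) * B (3 * suc t) (suc t)))
                ≡ (3 * suc t) * ((3 * t + 2) * ((3 * t + 1) * B (3 * t) t))
  C3-step t = begin
    (1 + t) * ((2 * t + 2) * ((2 * t + 1) * B (3 * suc t) (suc t)))   ≡⟨ swap (1 + t) (2 * t + 2) (2 * t + 1) _ ⟩
    (2 * t + 2) * ((2 * t + 1) * ((1 + t) * B (3 * suc t) (suc t)))   ≡⟨ cong (λ x → (2 * t + 2) * ((2 * t + 1) * x)) lower₁ ⟩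
    (2 * t + 2) * ((2 * t + 1) * ((3 * suc t) * B (3 * t + 2) t))     ≡⟨ swap (2 * t + 2) (2 * t + 1) (3 * suc t) _ ⟩
    (2 * t + 1) * ((3 * suc t) * ((2 * t + 2) * B (3 * t + 2) t))     ≡⟨ cong (λ x → (2 * t + 1) * ((3 * suc t) * x)) lower₂ ⟩
    (2 * t + 1) * ((3 * suc t) * ((3 * t + 2) * B (3 * t + 1) t))     ≡⟨ swap (2 * t + 1) (3 * suc t) (3 * t + 2) _ ⟩
    (3 * suc t) * ((3 * t + 2) * ((2 * t + 1) * B (3 * t + 1) t))     ≡⟨ cong (λ x → (3 * suc t) * ((3 * t + 2) * x)) (C3-lower t) ⟩
    (3 * suc t) * ((3 * t + 2) * ((3 * t + 1) * B (3 * t) t))         ∎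
    where
    open ≡-Reasoning
    swap : ∀ a b c x → a * (b * (c * x)) ≡ b * (c * (a * x))
    swap = ℕSolver.solve-∀
    top₁ : ∀ t → 3 * suc t ≡ suc (3 * t + 2)
    top₁ = ℕSolver.solve-∀
    top₂ : ∀ t → 3 * t + 2 ≡ suc (3 * t + 1)
    top₂ = ℕSolver.solve-∀
    split₂ : ∀ t → 3 * t + 1 ≡ t + (2 * t + 1)
    split₂ = ℕSolver.solve-∀
    coeff₂ : ∀ t → 2 * t + 2 ≡ suc (2 * t + 1)
    coeff₂ = ℕSolver.solve-∀
    lower₁ : (1 + t) * B (3 * suc t) (suc t) ≡ (3 * suc t) * B (3 * t + 2) t
    lower₁ = diagonal-step (3 * suc t) (3 * t + 2) (suc t) t (top₁ t) refl
    lower₂ : (2 * t + 2) * B (3 * t + 2) t ≡ (3 * t + 2) * B (3 * t + 1) t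
    lower₂ = row-step (3 * t + 2) (3 * t + 1) t (2 * t + 2) (2 * t + 1) (top₂ t) (split₂ t) (coeff₂ t)

  C2-step : ∀ t → (1 + t) * ((1 + t) * B (2 * suc t) (suc t)) ≡ (2 * suc t) * ((2 * t + 1) * B (2 * t) t)
  C2-step t = begin
    (1 + t) * ((1 + t) * B (2 * suc t) (suc t))   ≡⟨ cong ((1 + t) *_) (diagonal-step (2 * suc t) (2 * t + 1) (suc t) t (top t) refl) ⟩
    (1 + t) * ((2 * suc t) * B (2 * t + 1) t)     ≡⟨ swap (1 + t) (2 * suc t) _ ⟩
    (2 * suc t) * ((1 + t) * B (2 * t + 1) t)     ≡⟨ cong ((2 * suc t) *_) (C2-lower t) ⟩
    (2 * suc t) * ((2 * t + 1) * B (2 * t) t)     ∎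
    where
    open ≡-Reasoning
    swap : ∀ a b x → a * (b * x) ≡ b * (a * x)
    swap = ℕSolver.solve-∀
    top : ∀ t → 2 * suc t ≡ suc (2 * t + 1)
    top = ℕSolver.solve-∀

  -- The trinomial coefficient (3t)!/(t!)³ = C(3t, t)·C(2t, t) …
  trinomial : ℕ → ℕ
  trinomial t = B (3 * t) t * B (2 * t) t

  trinomial-step : ∀ t → (1 + t) * ((1 + t) * ((1 + t) * trinomial (suc t)))
                       ≡ (3 * suc t) * ((3 * t + 2) * ((3 * t + 1) * trinomial t))
  trinomial-step t = ℕP.*-cancelˡ-≡ _ _ ((2 * t + 2) * (2 * t + 1)) {{nonzero}} (begin
    (2 * t + 2) * (2 * t + 1) * ((1 + t) * ((1 + t) * ((1 + t) * (c3 * c2))))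
      ≡⟨ regroup (1 + t) (2 * t + 2) (2 * t + 1) c3 c2 ⟩
    ((1 + t) * ((2 * t + 2) * ((2 * t + 1) * c3))) * ((1 + t) * ((1 + t) * c2))
      ≡⟨ cong₂ _*_ (C3-step t) (C2-step t) ⟩
    ((3 * suc t) * ((3 * t + 2) * ((3 * t + 1) * B (3 * t) t))) * ((2 * suc t) * ((2 * t + 1) * B (2 * t) t))
      ≡⟨ regroup′ t (B (3 * t) t) (B (2 * t) t) ⟩
    (2 * t + 2) * (2 * t + 1) * ((3 * suc t) * ((3 * t + 2) * ((3 * t + 1) * trinomial t))) ∎)
    where
    open ≡-Reasoning
    c3 = B (3 * suc t) (suc t)
    c2 = B (2 * suc t) (suc t)
    nonzero : ℕ.NonZero ((2 * t + 2) * (2 * t + 1))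
    nonzero = ℕP.m*n≢0 (2 * t + 2) (2 * t + 1) {{plus-suc (2 * t) 1}} {{plus-suc (2 * t) 0}}
      where plus-suc : ∀ x k → ℕ.NonZero (x + suc k)
            plus-suc x k = subst ℕ.NonZero (sym (ℕP.+-suc x k)) _
    regroup : ∀ c a b x y → a * b * (c * (c * (c * (x * y)))) ≡ (c * (a * (b * x))) * (c * (c * y))
    regroup = ℕSolver.solve-∀
    regroup′ : ∀ t x y → ((3 * suc t) * ((3 * t + 2) * ((3 * t + 1) * x))) * ((2 * suc t) * ((2 * t + 1) * y))
                       ≡ (2 * t + 2) * (2 * t + 1) * ((3 * suc t) * ((3 * t + 2) * ((3 * t + 1) * (x * y))))
    regroup′ = ℕSolver.solve-∀

  -- The Catalan number C(2t,t)/(t+1), written as the integer C(2t,t) − C(2t,t+1).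
  Cat : ℕ → ℤ
  Cat t = + B (2 * t) t Z.- + B (2 * t) (suc t)

  -- (t+1)·Cat(t) = C(2t, t), since (t+1)·C(2t, t+1) = t·C(2t, t).
  Cat-scaled : ∀ t → + suc t Z.* Cat t ≡ + B (2 * t) t
  Cat-scaled t = begin
    + suc t Z.* (x Z.- y)                ≡⟨ distrib (+ suc t) x y ⟩
    + suc t Z.* x Z.- + suc t Z.* y      ≡⟨ cong (λ z → + suc t Z.* x Z.- z) lower ⟩
    + suc t Z.* x Z.- + t Z.* x          ≡⟨ cong (Z._- (+ t Z.* x)) (ZP.suc-* (+ t) x) ⟩
    (x Z.+ + t Z.* x) Z.- + t Z.* x      ≡⟨ cancel x (+ t Z.* x) ⟩
    x                                    ∎
    where
    open ≡-Reasoning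
    x = + B (2 * t) t
    y = + B (2 * t) (suc t)
    distrib : ∀ c x y → c Z.* (x Z.- y) ≡ c Z.* x Z.- c Z.* y
    distrib = solve-∀
    cancel : ∀ x z → (x Z.+ z) Z.- z ≡ x
    cancel = solve-∀
    2t∸t≡t : 2 * t ∸ t ≡ t
    2t∸t≡t = trans (cong (_∸ t) (cong (_+_ t) (ℕP.+-identityʳ t))) (ℕP.m+n∸n≡m t t)
    lower : + suc t Z.* y ≡ + t Z.* x
    lower = begin
      + suc t Z.* y                   ≡⟨ ZP.pos-* (suc t) _ ⟨
      + (suc t * B (2 * t) (suc t))   ≡⟨ cong +_ (absorption-∸ (2 * t) t) ⟩
      + ((2 * t ∸ t) * B (2 * t) t)   ≡⟨ cong (λ z → + (z * B (2 * t) t)) 2t∸t≡t ⟩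
      + (t * B (2 * t) t)             ≡⟨ ZP.pos-* t _ ⟩
      + t Z.* x                       ∎

  C2-odd : ∀ t → + B (2 * t + 1) t ≡ + (2 * t + 1) Z.* Cat t
  C2-odd t = ZP.*-cancelˡ-≡ (+ suc t) _ _ (begin
    + suc t Z.* + B (2 * t + 1) t              ≡⟨ ZP.pos-* (suc t) _ ⟨
    + (suc t * B (2 * t + 1) t)                ≡⟨ cong +_ (C2-lower t) ⟩
    + ((2 * t + 1) * B (2 * t) t)              ≡⟨ ZP.pos-* (2 * t + 1) _ ⟩
    + (2 * t + 1) Z.* + B (2 * t) t            ≡⟨ cong (+ (2 * t + 1) Z.*_) (Cat-scaled t) ⟨
    + (2 * t + 1) Z.* (+ suc t Z.* Cat t)      ≡⟨ swap (+ (2 * t + 1)) (+ suc t) (Cat t) ⟩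
    + suc t Z.* (+ (2 * t + 1) Z.* Cat t)      ∎)
    where
    open ≡-Reasoning
    swap : ∀ a b c → a Z.* (b Z.* c) ≡ b Z.* (a Z.* c)
    swap = solve-∀

pos-*⁴ : ∀ a b c d → + (a ℕ.* b ℕ.* c ℕ.* d) ≡ + a Z.* + b Z.* + c Z.* + d
pos-*⁴ a b c d = trans (ZP.pos-* (a ℕ.* b ℕ.* c) d) (cong (Z._* + d) (trans (ZP.pos-* (a ℕ.* b) c) (cong (Z._* + c) (ZP.pos-* a b))))

module Summands (M : ℕ) where
  open import Data.Nat using (_+_; _*_; _^_)
  open Binomial
  open CentralBinomials
  open import Data.Nat.Combinatorics using (_C_)
  open Sums

  N : ℕ
  N = suc M

  reduced : ℕ → ℤ
  reduced k = sign (N ∸ k) Z.* (Cat k Z.* + (B (3 * k) k * B M (3 * k) * B (N + k) k * 3 ^ (N ∸ (3 * k + 1))))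

  binomial-core : ∀ k → + B (3 * k + 1) k Z.* + B (2 * k + 1) k Z.* + B N (3 * k + 1)
                      ≡ + N Z.* (Cat k Z.* (+ B (3 * k) k Z.* + B M (3 * k)))
  binomial-core k = begin
    + c31 Z.* + B (2 * k + 1) k Z.* + cN                ≡⟨ cong (λ z → + c31 Z.* z Z.* + cN) (C2-odd k) ⟩
    + c31 Z.* (+ (2 * k + 1) Z.* Cat k) Z.* + cN        ≡⟨ regroup₁ (+ c31) (+ (2 * k + 1)) (Cat k) (+ cN) ⟩
    (+ c31 Z.* + (2 * k + 1)) Z.* (Cat k Z.* + cN)      ≡⟨ cong (Z._* (Cat k Z.* + cN)) lower₃ ⟩
    (+ (3 * k + 1) Z.* + b3) Z.* (Cat k Z.* + cN)       ≡⟨ regroup₂ (+ (3 * k + 1)) (+ b3) (Cat k) (+ cN) ⟩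
    (+ (3 * k + 1) Z.* + cN) Z.* (Cat k Z.* + b3)       ≡⟨ cong (Z._* (Cat k Z.* + b3)) lowerN ⟩
    (+ N Z.* + bM) Z.* (Cat k Z.* + b3)                 ≡⟨ regroup₃ (+ N) (+ bM) (Cat k) (+ b3) ⟩
    + N Z.* (Cat k Z.* (+ b3 Z.* + bM))                 ∎
    where
    open ≡-Reasoning
    c31 = B (3 * k + 1) k
    cN  = B N (3 * k + 1)
    b3  = B (3 * k) k
    bM  = B M (3 * k)
    lower₃ : + c31 Z.* + (2 * k + 1) ≡ + (3 * k + 1) Z.* + b3
    lower₃ = trans (sym (ZP.pos-* c31 (2 * k + 1))) (trans (cong +_ (trans (ℕP.*-comm c31 (2 * k + 1)) (C3-lower k))) (ZP.pos-* (3 * k + 1) b3))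
    lowerN : + (3 * k + 1) Z.* + cN ≡ + N Z.* + bM
    lowerN = trans (sym (ZP.pos-* (3 * k + 1) cN)) (trans (cong +_ (diagonal-step N M (3 * k + 1) (3 * k) refl (ℕP.+-comm (3 * k) 1))) (ZP.pos-* N bM))
    regroup₁ : ∀ x u y z → x Z.* (u Z.* y) Z.* z ≡ (x Z.* u) Z.* (y Z.* z)
    regroup₁ = solve-∀
    regroup₂ : ∀ u x y z → (u Z.* x) Z.* (y Z.* z) ≡ (u Z.* z) Z.* (y Z.* x)
    regroup₂ = solve-∀
    regroup₃ : ∀ n x y b → (n Z.* x) Z.* (y Z.* b) ≡ n Z.* (y Z.* (b Z.* x))
    regroup₃ = solve-∀

  term-factor : ∀ k → term N k ≡ + N Z.* reduced k
  term-factor k = begin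
    term N k
      ≡⟨ cong (λ z → sign (N ∸ k) Z.* + z) as-B ⟩
    sign (N ∸ k) Z.* + (c31 * c21 * cN * (c * e))
      ≡⟨ cong (sign (N ∸ k) Z.*_) (trans (pos-*⁴ c31 c21 cN (c * e)) (cong (+ c31 Z.* + c21 Z.* + cN Z.*_) (ZP.pos-* c e))) ⟩
    sign (N ∸ k) Z.* (+ c31 Z.* + c21 Z.* + cN Z.* (+ c Z.* + e))
      ≡⟨ cong (λ z → sign (N ∸ k) Z.* (z Z.* (+ c Z.* + e))) (binomial-core k) ⟩
    sign (N ∸ k) Z.* (+ N Z.* (Cat k Z.* (+ b3 Z.* + bM)) Z.* (+ c Z.* + e))
      ≡⟨ regroup (sign (N ∸ k)) (+ N) (Cat k) (+ b3) (+ bM) (+ c) (+ e) ⟩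
    + N Z.* (sign (N ∸ k) Z.* (Cat k Z.* (+ b3 Z.* + bM Z.* + c Z.* + e)))
      ≡⟨ cong (λ z → + N Z.* (sign (N ∸ k) Z.* (Cat k Z.* z))) (pos-*⁴ b3 bM c e) ⟨
    + N Z.* reduced k ∎
    where
    open ≡-Reasoning
    c31 = B (3 * k + 1) k
    c21 = B (2 * k + 1) k
    cN  = B N (3 * k + 1)
    c   = B (N + k) k
    e   = 3 ^ (N ∸ (3 * k + 1))
    b3  = B (3 * k) k
    bM  = B M (3 * k)
    as-B : ((3 * k + 1) C k) * ((2 * k + 1) C k) * ((N C (3 * k + 1)) * ((N + k) C k)) * e ≡ c31 * c21 * cN * (c * e)
    as-B = trans (cong (_* e) (sym (cong₂ _*_ (cong₂ _*_ (B≡C (3 * k + 1) k) (B≡C (2 * k + 1) k)) (cong₂ _*_ (B≡C N (3 * k + 1)) (B≡C (N + k) k)))))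
                 (reassociate (c31 * c21) cN c e)
      where reassociate : ∀ a b c e → a * (b * c) * e ≡ a * b * (c * e)
            reassociate = ℕSolver.solve-∀
    regroup : ∀ σ n y b b′ c e → σ Z.* (n Z.* (y Z.* (b Z.* b′)) Z.* (c Z.* e)) ≡ n Z.* (σ Z.* (y Z.* (b Z.* b′ Z.* c Z.* e)))
    regroup = solve-∀

  -- Summands with N ≤ 3k vanish, since then C(N-1, 3k) = 0.
  reduced-vanishes : ∀ k → N ≤ 3 * k → reduced k ≡ 0ℤ
  reduced-vanishes k N≤3k = begin
    sign (N ∸ k) Z.* (Cat k Z.* + (B (3 * k) k * B M (3 * k) * c * e))  ≡⟨ cong (λ z → sign (N ∸ k) Z.* (Cat k Z.* + (B (3 * k) k * z * c * e))) (B-above M (3 * k) N≤3k) ⟩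
    sign (N ∸ k) Z.* (Cat k Z.* + (B (3 * k) k * 0 * c * e))            ≡⟨ cong (λ z → sign (N ∸ k) Z.* (Cat k Z.* + (z * c * e))) (ℕP.*-zeroʳ (B (3 * k) k)) ⟩
    sign (N ∸ k) Z.* (Cat k Z.* 0ℤ)                                      ≡⟨ cong (sign (N ∸ k) Z.*_) (ZP.*-zeroʳ (Cat k)) ⟩
    sign (N ∸ k) Z.* 0ℤ                                                  ≡⟨ ZP.*-zeroʳ (sign (N ∸ k)) ⟩
    0ℤ                                                                   ∎
    where
    open ≡-Reasoning
    c = B (N + k) k
    e = 3 ^ (N ∸ (3 * k + 1))

  private
    K : ℕ
    K = (N + 2) / 3

    N≤3K : N ≤ 3 * K
    N≤3K = ℕP.+-cancelˡ-≤ 2 N (3 * K) (begin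
      2 + N                      ≡⟨ ℕP.+-comm 2 N ⟩
      N + 2                      ≡⟨ m≡m%n+[m/n]*n (N + 2) 3 ⟩
      (N + 2) % 3 + K * 3        ≤⟨ ℕP.+-monoˡ-≤ (K * 3) (ℕP.≤-pred (m%n<n (N + 2) 3)) ⟩
      2 + K * 3                  ≡⟨ cong (_+_ 2) (ℕP.*-comm K 3) ⟩
      2 + 3 * K                  ∎)
      where open ℕP.≤-Reasoning

    K≤N : K ≤ N
    K≤N = ℕP.*-cancelʳ-≤ K N 3 (begin
      K * 3                      ≤⟨ m/n*n≤m (N + 2) 3 ⟩
      N + 2                      ≤⟨ ℕP.m≤m+n (N + 2) (M + M) ⟩
      N + 2 + (M + M)            ≡⟨ spread M ⟩
      N * 3                      ∎)
      where
      open ℕP.≤-Reasoning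
      spread : ∀ M → suc M + 2 + (M + M) ≡ suc M * 3
      spread = ℕSolver.solve-∀

  -- a₁(N) = N · Σ_{k < L} reduced(k) for every L ≥ N: the summation range of a₁ may be
  -- extended by vanishing summands.
  a₁-factor : ∀ L → N ≤ L → a₁ N ≡ + N Z.* Σ< L reduced
  a₁-factor L N≤L = begin
    a₁ N                                      ≡⟨ sumℤ-upTo (term N) K ⟩
    Σ< K (term N)                             ≡⟨ Σ<-cong K term-factor ⟩
    Σ< K (λ k → + N Z.* reduced k)            ≡⟨ Σ<-*ˡ K (+ N) reduced ⟩
    + N Z.* Σ< K reduced                      ≡⟨ cong (+ N Z.*_) (Σ<-extend K (L ∸ K) reduced (λ j → reduced-vanishes (K + j) (N≤3[K+j] j))) ⟨
    + N Z.* Σ< (K + (L ∸ K)) reduced          ≡⟨ cong (λ x → + N Z.* Σ< x reduced) (ℕP.m+[n∸m]≡n (ℕP.≤-trans K≤N N≤L)) ⟩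
    + N Z.* Σ< L reduced                      ∎
    where
    open ≡-Reasoning
    N≤3[K+j] : ∀ j → N ≤ 3 * (K + j)
    N≤3[K+j] j = ℕP.≤-trans N≤3K (ℕP.*-monoʳ-≤ 3 (ℕP.m≤m+n K j))

when : ∀ {A : Set} → Dec A → ℤ → ℤ
when (yes _) x = x
when (no _)  _ = 0ℤ

when-yes : ∀ {A : Set} (d : Dec A) x → A → when d x ≡ x
when-yes (yes _) x _ = refl
when-yes (no ¬a) x a = ⊥-elim (¬a a)

when-no : ∀ {A : Set} (d : Dec A) x → ¬ A → when d x ≡ 0ℤ
when-no (yes a) x ¬a = ⊥-elim (¬a a)
when-no (no _)  x _  = refl

residue-mod-3 : ∀ x → (Σ ℕ λ m → x ≡ m ℕ.* 3) ⊎ (Σ ℕ λ m → Σ ℕ λ c → c ≤ 1 × x ≡ 3 ℕ.* m ℕ.+ 1 ℕ.+ c)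
residue-mod-3 x with x % 3 | m%n<n x 3 | m≡m%n+[m/n]*n x 3
... | zero  | _             | x≡ = inj₁ (x / 3 , x≡)
... | suc c | s≤s (s≤s c≤1) | x≡ = inj₂ (x / 3 , c , c≤1 , trans x≡ (rearrange c (x / 3)))
  where rearrange : ∀ c m → suc c ℕ.+ m ℕ.* 3 ≡ 3 ℕ.* m ℕ.+ 1 ℕ.+ c
        rearrange = ℕSolver.solve-∀

prime-pred-even : ∀ q → Prime (suc q) → 2 ≤ q → Σ ℕ λ e → q ≡ e ℕ.* 2
prime-pred-even q isPrime 2≤q with q % 2 | m%n<n q 2 | m≡m%n+[m/n]*n q 2
... | zero        | _            | q≡ = q / 2 , q≡
... | suc zero    | _            | q≡ = ⊥-elim (prime⇒¬composite isPrime (composite 2<p (ℕD.divides (suc (q / 2)) (cong suc q≡))))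
  where 2<p = s≤s 2≤q
... | suc (suc _) | s≤s (s≤s ()) | _

module CentralSum (q : ℕ) (isPrime : Prime (suc q)) where
  open import Data.Nat using (_+_; _*_; _^_)
  open Sums
  open Binomial
  open CentralBinomials
  open Signs
  open Lucas q isPrime

  -- The factor contributed by a low base-p digit t of the summation index.
  digit-term : ℕ → ℤ
  digit-term t = sign t Z.* (Cat t Z.* + (B (3 * t) t * B q (3 * t) * 3 ^ (q ∸ 3 * t)))

  -- It only survives when 3t < p (otherwise a carry occurs in C(3k, k) or in Cat(k)).
  low-term : ℕ → ℤ
  low-term t = when (3 * t ℕ.<? p) (digit-term t)

  -- digit-term with C(p-1, 3t) ≡ (-1)^(3t) absorbed into the sign.
  simplified : ℕ → ℤ
  simplified t = Cat t Z.* + (B (3 * t) t * 3 ^ (q ∸ 3 * t))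

  digit-term≈ : ∀ t → 3 * t < p → digit-term t ≈ simplified t
  digit-term≈ t 3t<p = begin
    sign t Z.* (Cat t Z.* + (B (3 * t) t * B q (3 * t) * e))
      ≡⟨ cong (λ z → sign t Z.* (Cat t Z.* z)) (trans (cong +_ (swap (B (3 * t) t) (B q (3 * t)) e)) (ZP.pos-* (B q (3 * t)) _)) ⟩
    sign t Z.* (Cat t Z.* (+ B q (3 * t) Z.* + (B (3 * t) t * e)))
      ≡⟨ regroup (sign t) (Cat t) (+ B q (3 * t)) _ ⟩
    (sign t Z.* + B q (3 * t)) Z.* simplified t
      ≈⟨ *-congʳ (simplified t) (*-congˡ (sign t) (B-pred≈sign (3 * t) 3t<p)) ⟩
    (sign t Z.* sign (3 * t)) Z.* simplified t
      ≡⟨ trans (cong (Z._* simplified t) (sign-3* t)) (ZP.*-identityˡ (simplified t)) ⟩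
    simplified t ∎
    where
    open ≈-Reasoning
    e = 3 ^ (q ∸ 3 * t)
    swap : ∀ x y z → x * y * z ≡ y * (x * z)
    swap x y z = trans (cong (_* z) (ℕP.*-comm x y)) (ℕP.*-assoc y x z)
    regroup : ∀ s c b w → s Z.* (c Z.* (b Z.* w)) ≡ (s Z.* b) Z.* (c Z.* w)
    regroup = solve-∀

  module Thirds (m c : ℕ) (c≤1 : c ≤ 1) (1≤m : 1 ≤ m) (p≡ : p ≡ 3 * m + 1 + c) where

    a : ℕ
    a = 2 * m + c

    a+m+1≡p : a + suc m ≡ p
    a+m+1≡p = trans (rearrange m c) (sym p≡)
      where rearrange : ∀ m c → 2 * m + c + suc m ≡ 3 * m + 1 + c
            rearrange = ℕSolver.solve-∀

    3m<p : 3 * m < p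
    3m<p = ℕP.≤-trans (ℕP.m≤m+n (suc (3 * m)) c) (ℕP.≤-reflexive (trans (cong (_+ c) (ℕP.+-comm 1 (3 * m))) (sym p≡)))

    p≤3[m+1] : p ≤ 3 * suc m
    p≤3[m+1] = ℕP.≤-trans (ℕP.≤-reflexive p≡) (ℕP.≤-trans (ℕP.+-monoʳ-≤ (3 * m + 1) (ℕP.≤-trans c≤1 (s≤s z≤n))) (ℕP.≤-reflexive (expand m)))
      where expand : ∀ m → 3 * m + 1 + 2 ≡ 3 * suc m
            expand = ℕSolver.solve-∀

    m+1<p : suc m < p
    m+1<p = ℕP.≤-<-trans (ℕP.≤-trans (ℕP.m<m+n m 1≤m) (ℕP.+-monoʳ-≤ m (ℕP.m≤m+n m (m + 0)))) 3m<p

    -- The polynomial identity behind `thirds`, for each of the two residues c.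
    private
      thirds-identity : ∀ c t u → c ≤ 1 → Σ ℕ λ d → 9 * ((t + 2 * u + c) * u) + d * (3 * t + 3 * u + 1 + c)
                                                   ≡ (3 * t + 1) * (3 * t + 2) + (6 * u) * (3 * t + 3 * u + 1 + c)
      thirds-identity zero          t u _          = 3 * t + 2 , residue₁ t u
        where residue₁ : ∀ t u → 9 * ((t + 2 * u + 0) * u) + (3 * t + 2) * (3 * t + 3 * u + 1 + 0)
                                 ≡ (3 * t + 1) * (3 * t + 2) + (6 * u) * (3 * t + 3 * u + 1 + 0)
              residue₁ = ℕSolver.solve-∀
      thirds-identity (suc zero)    t u _          = 3 * t + 1 , residue₂ t u
        where residue₂ : ∀ t u → 9 * ((t + 2 * u + 1) * u) + (3 * t + 1) * (3 * t + 3 * u + 1 + 1)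
                                 ≡ (3 * t + 1) * (3 * t + 2) + (6 * u) * (3 * t + 3 * u + 1 + 1)
              residue₂ = ℕSolver.solve-∀
      thirds-identity (suc (suc c)) _ _ (s≤s ())

    -- 9(a-t)(m-t) ≡ (3t+1)(3t+2) (mod p) for t ≤ m: the rows C(a, ·) and C(m, ·)
    -- together mimic, modulo p, the growth of C(3t, t)·C(2t, t).
    thirds : ∀ t → t ≤ m → + (9 * ((a ∸ t) * (m ∸ t))) ≈ + ((3 * t + 1) * (3 * t + 2))
    thirds t t≤m with thirds-identity c t (m ∸ t) c≤1
    ... | d , e = ≈-trans (≈-reflexive (cong (λ x → + (9 * (x * u))) a∸t))
                          (≈-fromℕ _ _ d (6 * u) (subst (λ P → 9 * ((t + 2 * u + c) * u) + d * P ≡ (3 * t + 1) * (3 * t + 2) + 6 * u * P) (sym p≡′) e))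
      where
      u = m ∸ t
      m≡t+u : m ≡ t + u
      m≡t+u = sym (ℕP.m+[n∸m]≡n t≤m)
      a∸t : a ∸ t ≡ t + 2 * u + c
      a∸t = trans (cong (λ x → 2 * x + c ∸ t) m≡t+u) (trans (cong (_∸ t) (split t u c)) (ℕP.m+n∸m≡n t _))
        where split : ∀ t u c → 2 * (t + u) + c ≡ t + (t + 2 * u + c)
              split = ℕSolver.solve-∀
      p≡′ : p ≡ 3 * t + 3 * u + 1 + c
      p≡′ = trans p≡ (trans (cong (λ x → 3 * x + 1 + c) m≡t+u) (split t u c))
        where split : ∀ t u c → 3 * (t + u) + 1 + c ≡ 3 * t + 3 * u + 1 + c
              split = ℕSolver.solve-∀

    private
      cancel-cube : ∀ t {x y} → suc t < p → + (suc t * (suc t * (suc t * x))) ≈ + (suc t * (suc t * (suc t * y))) → + x ≈ + y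
      cancel-cube t t+1<p e = cancelℕ (suc t) (s≤s z≤n) t+1<p (cancelℕ (suc t) (s≤s z≤n) t+1<p (cancelℕ (suc t) (s≤s z≤n) t+1<p e))

    rows-step : ∀ t → suc t * (suc t * (B a (suc t) * B m (suc t))) ≡ (a ∸ t) * (m ∸ t) * (B a t * B m t)
    rows-step t = begin
      suc t * (suc t * (B a (suc t) * B m (suc t)))        ≡⟨ regroup (suc t) (B a (suc t)) (B m (suc t)) ⟩
      (suc t * B a (suc t)) * (suc t * B m (suc t))        ≡⟨ cong₂ _*_ (absorption-∸ a t) (absorption-∸ m t) ⟩
      ((a ∸ t) * B a t) * ((m ∸ t) * B m t)                ≡⟨ regroup′ (a ∸ t) (B a t) (m ∸ t) (B m t) ⟩
      (a ∸ t) * (m ∸ t) * (B a t * B m t)                  ∎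
      where
      open ≡-Reasoning
      regroup : ∀ s x y → s * (s * (x * y)) ≡ (s * x) * (s * y)
      regroup = ℕSolver.solve-∀
      regroup′ : ∀ a x m y → (a * x) * (m * y) ≡ a * m * (x * y)
      regroup′ = ℕSolver.solve-∀

    -- One step of the right-hand side of `trinomial≈`, after `thirds` is applied.
    private
      rows-rhs-step : ∀ t → (3 * suc t) * (9 * ((a ∸ t) * (m ∸ t))) * (27 ^ t * (B a t * B m t))
                          ≡ suc t * (suc t * (suc t * (27 ^ suc t * (B a (suc t) * B m (suc t)))))
      rows-rhs-step t = begin
        (3 * s) * (9 * ((a ∸ t) * (m ∸ t))) * (27 ^ t * (B a t * B m t))  ≡⟨ gather s (a ∸ t) (m ∸ t) (27 ^ t) (B a t * B m t) ⟩
        27 * 27 ^ t * s * ((a ∸ t) * (m ∸ t) * (B a t * B m t))           ≡⟨ cong (λ z → 27 * 27 ^ t * s * z) (rows-step t) ⟨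
        27 * 27 ^ t * s * (s * (s * (B a (suc t) * B m (suc t))))         ≡⟨ spread s (27 ^ t) _ ⟩
        s * (s * (s * (27 ^ suc t * (B a (suc t) * B m (suc t)))))        ∎
        where
        open ≡-Reasoning
        s = suc t
        gather : ∀ s A M P Y → (3 * s) * (9 * (A * M)) * (P * Y) ≡ 27 * P * s * (A * M * Y)
        gather = ℕSolver.solve-∀
        spread : ∀ s P Y′ → 27 * P * s * (s * (s * Y′)) ≡ s * (s * (s * (27 * P * Y′)))
        spread = ℕSolver.solve-∀

    -- C(3t, t)·C(2t, t) ≡ 27^t·C(a, t)·C(m, t) (mod p) for t ≤ m: both sides start at 1
    -- and, by `thirds`, obey the same recurrence (`trinomial-step`, `rows-step`).
    trinomial≈ : ∀ t → t ≤ m → + trinomial t ≈ + (27 ^ t * (B a t * B m t))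
    trinomial≈ zero    _     = ≈-refl
    trinomial≈ (suc t) t+1≤m = cancel-cube t (ℕP.≤-<-trans t+1≤m (ℕP.<-trans (ℕP.n<1+n m) m+1<p)) (begin
      + (s * (s * (s * trinomial (suc t))))                              ≡⟨ cong +_ (trinomial-step t) ⟩
      + ((3 * s) * ((3 * t + 2) * ((3 * t + 1) * trinomial t)))          ≈⟨ *-congℕ (≈-refl {+ (3 * s)}) (*-congℕ (≈-refl {+ (3 * t + 2)}) (*-congℕ (≈-refl {+ (3 * t + 1)}) (trinomial≈ t t≤m))) ⟩
      + ((3 * s) * ((3 * t + 2) * ((3 * t + 1) * y)))                    ≡⟨ cong +_ (regroup (3 * s) (3 * t + 2) (3 * t + 1) y) ⟩
      + ((3 * s) * ((3 * t + 1) * (3 * t + 2)) * y)                      ≈⟨ *-congℕ (*-congℕ (≈-refl {+ (3 * s)}) (≈-sym (thirds t t≤m))) (≈-refl {+ y}) ⟩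
      + ((3 * s) * (9 * ((a ∸ t) * (m ∸ t))) * y)                        ≡⟨ cong +_ (rows-rhs-step t) ⟩
      + (s * (s * (s * (27 ^ suc t * (B a (suc t) * B m (suc t))))))     ∎)
      where
      open ≈-Reasoning
      s = suc t
      t≤m = ℕP.<⇒≤ t+1≤m
      y = 27 ^ t * (B a t * B m t)
      regroup : ∀ x y z w → x * (y * (z * w)) ≡ x * (z * y) * w
      regroup = ℕSolver.solve-∀

    -- (m+1)·Cat(t)·C(3t, t) ≡ 27^t·C(a, t)·C(m+1, t+1), dividing `trinomial≈` by t+1.
    catalan≈ : ∀ t → t ≤ m → + suc m Z.* (Cat t Z.* + B (3 * t) t) ≈ + (27 ^ t * (B a t * B (suc m) (suc t)))
    catalan≈ t t≤m = cancel (suc t) (unit (suc t) (s≤s z≤n) (ℕP.≤-<-trans (s≤s t≤m) m+1<p)) (begin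
      + suc t Z.* (+ suc m Z.* (Cat t Z.* + b₃))           ≡⟨ regroup (+ suc t) (+ suc m) (Cat t) (+ b₃) ⟩
      + suc m Z.* ((+ suc t Z.* Cat t) Z.* + b₃)           ≡⟨ cong (λ z → + suc m Z.* (z Z.* + b₃)) (Cat-scaled t) ⟩
      + suc m Z.* (+ b₂ Z.* + b₃)                          ≡⟨ cong (+ suc m Z.*_) (trans (sym (ZP.pos-* b₂ b₃)) (cong +_ (ℕP.*-comm b₂ b₃))) ⟩
      + suc m Z.* + trinomial t                            ≡⟨ ZP.pos-* (suc m) (trinomial t) ⟨
      + (suc m * trinomial t)                              ≈⟨ *-congℕ (≈-refl {+ suc m}) (trinomial≈ t t≤m) ⟩
      + (suc m * (27 ^ t * (B a t * B m t)))               ≡⟨ cong +_ shift-row ⟩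
      + (suc t * (27 ^ t * (B a t * B (suc m) (suc t))))   ≡⟨ ZP.pos-* (suc t) _ ⟩
      + suc t Z.* + (27 ^ t * (B a t * B (suc m) (suc t))) ∎)
      where
      open ≈-Reasoning
      b₃ = B (3 * t) t
      b₂ = B (2 * t) t
      regroup : ∀ u v c b → u Z.* (v Z.* (c Z.* b)) ≡ v Z.* ((u Z.* c) Z.* b)
      regroup = solve-∀
      shift-row : suc m * (27 ^ t * (B a t * B m t)) ≡ suc t * (27 ^ t * (B a t * B (suc m) (suc t)))
      shift-row = trans (out (suc m) (27 ^ t) (B a t) (B m t))
                   (trans (cong (27 ^ t * B a t *_) (sym (absorption m t))) (sym (out (suc t) (27 ^ t) (B a t) (B (suc m) (suc t)))))
        where out : ∀ x y z w → x * (y * (z * w)) ≡ y * z * (x * w)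
              out = ℕSolver.solve-∀

    simplified≈ : ∀ t → t ≤ m → + suc m Z.* simplified t ≈ + (3 ^ q) Z.* (+ B a t Z.* + B (suc m) (m ∸ t))
    simplified≈ t t≤m = begin
      + suc m Z.* (Cat t Z.* + (B (3 * t) t * e))          ≡⟨ cong (λ z → + suc m Z.* (Cat t Z.* z)) (ZP.pos-* (B (3 * t) t) e) ⟩
      + suc m Z.* (Cat t Z.* (+ B (3 * t) t Z.* + e))      ≡⟨ regroup (+ suc m) (Cat t) (+ B (3 * t) t) (+ e) ⟩
      (+ suc m Z.* (Cat t Z.* + B (3 * t) t)) Z.* + e      ≈⟨ *-congʳ (+ e) (catalan≈ t t≤m) ⟩
      + (27 ^ t * w) Z.* + e                               ≡⟨ ZP.pos-* (27 ^ t * w) e ⟨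
      + (27 ^ t * w * e)                                   ≡⟨ cong +_ (trans (swap (27 ^ t) w e) (cong (_* w) powers)) ⟩
      + (3 ^ q * w)                                        ≡⟨ ZP.pos-* (3 ^ q) w ⟩
      + (3 ^ q) Z.* + (B a t * B (suc m) (suc t))          ≡⟨ cong (+ (3 ^ q) Z.*_) (trans (ZP.pos-* (B a t) _) (cong (λ z → + B a t Z.* + z) (B-sym (suc m) (suc t) (s≤s t≤m)))) ⟩
      + (3 ^ q) Z.* (+ B a t Z.* + B (suc m) (m ∸ t))      ∎
      where
      open ≈-Reasoning
      e = 3 ^ (q ∸ 3 * t)
      w = B a t * B (suc m) (suc t)
      regroup : ∀ u c b e → u Z.* (c Z.* (b Z.* e)) ≡ (u Z.* (c Z.* b)) Z.* e
      regroup = solve-∀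
      swap : ∀ x w e → x * w * e ≡ x * e * w
      swap = ℕSolver.solve-∀
      3t≤q : 3 * t ≤ q
      3t≤q = ℕP.≤-pred (ℕP.≤-<-trans (ℕP.*-monoʳ-≤ 3 t≤m) 3m<p)
      powers : 27 ^ t * 3 ^ (q ∸ 3 * t) ≡ 3 ^ q
      powers = trans (cong (_* e) (ℕP.^-*-assoc 3 3 t))
                 (trans (sym (ℕP.^-distribˡ-+-* 3 (3 * t) (q ∸ 3 * t))) (cong (3 ^_) (ℕP.m+[n∸m]≡n 3t≤q)))

    -- Only t ≤ m contribute to the central sum; multiplied by the unit m+1 it becomes
    -- 3^(p-1)·Σ_{t ≤ m} C(a, t)·C(m+1, m-t) = 3^(p-1)·C(p, m) ≡ 0 by Vandermonde.
    central-sum-vanishes : Σ< p low-term ≈ 0ℤ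
    central-sum-vanishes = begin
      Σ< p low-term                                ≡⟨ cong (λ n → Σ< n low-term) (ℕP.m+[n∸m]≡n (ℕP.<⇒≤ m+1<p)) ⟨
      Σ< (suc m + (p ∸ suc m)) low-term            ≡⟨ Σ<-extend (suc m) (p ∸ suc m) low-term high-vanish ⟩
      Σ< (suc m) low-term                          ≈⟨ Σ<-≈< (suc m) low≈ ⟩
      Σ< (suc m) simplified                        ≈⟨ cancel (suc m) (unit (suc m) (s≤s z≤n) m+1<p) scaled ⟩
      0ℤ                                           ∎
      where
      open ≈-Reasoning
      high-vanish : ∀ j → low-term (suc m + j) ≡ 0ℤ
      high-vanish j = when-no (3 * (suc m + j) ℕ.<? p) _
        (λ lt → ℕP.<⇒≱ lt (ℕP.≤-trans p≤3[m+1] (ℕP.*-monoʳ-≤ 3 (ℕP.m≤m+n (suc m) j))))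
      low≈ : ∀ t → t < suc m → low-term t ≈ simplified t
      low≈ t t<m+1 = ≈-trans (≈-reflexive (when-yes (3 * t ℕ.<? p) _ 3t<p)) (digit-term≈ t 3t<p)
        where 3t<p = ℕP.≤-<-trans (ℕP.*-monoʳ-≤ 3 (ℕP.≤-pred t<m+1)) 3m<p
      w : ℕ → ℤ
      w t = + B a t Z.* + B (suc m) (m ∸ t)
      scaled : + suc m Z.* Σ< (suc m) simplified ≈ + suc m Z.* 0ℤ
      scaled = begin
        + suc m Z.* Σ< (suc m) simplified              ≡⟨ Σ<-*ˡ (suc m) (+ suc m) simplified ⟨
        Σ< (suc m) (λ t → + suc m Z.* simplified t)    ≈⟨ Σ<-≈< (suc m) (λ t t<m+1 → simplified≈ t (ℕP.≤-pred t<m+1)) ⟩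
        Σ< (suc m) (λ t → + (3 ^ q) Z.* w t)           ≡⟨ Σ<-*ˡ (suc m) (+ (3 ^ q)) w ⟩
        + (3 ^ q) Z.* Σ< (suc m) w                     ≡⟨ cong (+ (3 ^ q) Z.*_) (trans (vandermonde a (suc m) m) (cong (λ n → + B n m) a+m+1≡p)) ⟩
        + (3 ^ q) Z.* + B p m                          ≈⟨ *-congˡ (+ (3 ^ q)) (B-prime≈0 m 1≤m (ℕP.<-trans (ℕP.n<1+n m) m+1<p)) ⟩
        + (3 ^ q) Z.* 0ℤ                               ≡⟨ trans (ZP.*-zeroʳ (+ (3 ^ q))) (sym (ZP.*-zeroʳ (+ suc m))) ⟩
        + suc m Z.* 0ℤ                                 ∎

  -- The central sum vanishes modulo p once p ≥ 5 (then p is not divisible by 3 and p > 3).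
  central-sum : 4 ≤ q → Σ< p low-term ≈ 0ℤ
  central-sum 4≤q with residue-mod-3 p
  ... | inj₁ (m , p≡m*3)               = ⊥-elim (prime⇒¬composite isPrime (composite 3<p (ℕD.divides m p≡m*3)))
    where 3<p = ℕP.<-≤-trans (s≤s (s≤s (s≤s (s≤s z≤n)))) (s≤s 4≤q)
  ... | inj₂ (zero , c , c≤1 , p≡)    = ⊥-elim (ℕP.<⇒≱ (s≤s (ℕP.≤-trans (s≤s (s≤s z≤n)) 4≤q)) (ℕP.≤-trans (ℕP.≤-reflexive p≡) (s≤s c≤1)))
  ... | inj₂ (suc m , c , c≤1 , p≡)   = Thirds.central-sum-vanishes (suc m) c c≤1 (s≤s z≤n) p≡

module Decomposition (q : ℕ) (isPrime : Prime (suc q)) (4≤q : 4 ≤ q) (n′ : ℕ) where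
  open import Data.Nat using (_+_; _*_; _^_)
  open Sums
  open Binomial
  open CentralBinomials
  open Signs
  open Lucas q isPrime
  open CentralSum q isPrime

  n : ℕ
  n = suc n′

  -- p·n = M + 1
  M : ℕ
  M = n′ + q * n

  open Summands M public

  -- The factor contributed by the high digits s of k = s·p + t.
  high-term : ℕ → ℤ
  high-term s = sign (n ∸ s) Z.* (+ B (2 * s) s Z.* + (B (3 * s) s * B n′ (3 * s) * B (n + s) s * (3 ^ p) ^ (n′ ∸ 3 * s)))

  private
    scale-digits : ∀ x s t → x * (s * p + t) ≡ (x * s) * p + x * t
    scale-digits x s t = distrib x s t p
      where distrib : ∀ x s t p → x * (s * p + t) ≡ (x * s) * p + x * t
            distrib = ℕSolver.solve-∀

    M-digits : M ≡ n′ * p + q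
    M-digits = rearrange n′ q
      where rearrange : ∀ n′ q → n′ + q * suc n′ ≡ n′ * suc q + q
            rearrange = ℕSolver.solve-∀

    N+k-digits : ∀ s t → N + (s * p + t) ≡ (n + s) * p + t
    N+k-digits s t = rearrange q n′ s t
      where rearrange : ∀ q n′ s t → suc q * suc n′ + (s * suc q + t) ≡ (suc n′ + s) * suc q + t
            rearrange = ℕSolver.solve-∀

    k≤N : ∀ s t → s < n → t < p → s * p + t ≤ N
    k≤N s t s<n t<p = ℕP.≤-trans (ℕP.<⇒≤ (ℕP.+-monoʳ-< (s * p) t<p))
                        (ℕP.≤-trans (ℕP.≤-reflexive (ℕP.+-comm (s * p) p)) (ℕP.≤-trans (ℕP.*-monoˡ-≤ p s<n) (ℕP.≤-reflexive (ℕP.*-comm n p))))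

    p-odd : Σ ℕ λ e → p ≡ suc (2 * e)
    p-odd with prime-pred-even q isPrime (ℕP.≤-trans (s≤s (s≤s z≤n)) 4≤q)
    ... | e , q≡ = e , cong suc (trans q≡ (ℕP.*-comm e 2))

    sign-*p : ∀ a → sign (a * p) ≡ sign a
    sign-*p a with p-odd
    ... | e , p≡ = trans (cong (λ x → sign (a * x)) p≡) (sign-*odd a e)

  sign-digits : ∀ s t → s < n → t < p → sign (N ∸ (s * p + t)) ≡ sign (n ∸ s) Z.* sign t
  sign-digits s t s<n t<p = begin
    sign (N ∸ (s * p + t))                    ≡⟨ sign-∸ N _ (k≤N s t s<n t<p) ⟩
    sign N Z.* sign (s * p + t)               ≡⟨ cong₂ Z._*_ (trans (cong sign (ℕP.*-comm p n)) (sign-*p n)) (sign-+ (s * p) t) ⟩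
    sign n Z.* (sign (s * p) Z.* sign t)      ≡⟨ cong (λ x → sign n Z.* (x Z.* sign t)) (sign-*p s) ⟩
    sign n Z.* (sign s Z.* sign t)            ≡⟨ ZP.*-assoc (sign n) (sign s) (sign t) ⟨
    sign n Z.* sign s Z.* sign t              ≡⟨ cong (Z._* sign t) (sign-∸ n s (ℕP.<⇒≤ s<n)) ⟨
    sign (n ∸ s) Z.* sign t                   ∎
    where open ≡-Reasoning

  private
    t+1<p : ∀ t → 3 * t < p + p → suc t < p
    t+1<p t 3t<2p = ℕP.*-cancelˡ-≤ 3 (begin
      3 * suc (suc t)    ≡⟨ expand t ⟩
      suc (3 * t) + 5    ≤⟨ ℕP.+-monoˡ-≤ 5 3t<2p ⟩
      (p + p) + 5        ≤⟨ ℕP.+-monoʳ-≤ (p + p) (s≤s 4≤q) ⟩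
      (p + p) + p        ≡⟨ triple p ⟩
      3 * p              ∎)
      where
      open ℕP.≤-Reasoning
      expand : ∀ t → 3 * suc (suc t) ≡ suc (3 * t) + 5
      expand = ℕSolver.solve-∀
      triple : ∀ p → (p + p) + p ≡ 3 * p
      triple = ℕSolver.solve-∀

  Cat-digits : ∀ s t → 3 * t < p → Cat (s * p + t) ≈ + B (2 * s) s Z.* Cat t
  Cat-digits s t 3t<p = begin
    + B (2 * k) k Z.- + B (2 * k) (suc k)
      ≡⟨ cong₂ (λ x y → + B x k Z.- + B x y) (scale-digits 2 s t) (sym (ℕP.+-suc (s * p) t)) ⟩
    + B (2 * s * p + 2 * t) (s * p + t) Z.- + B (2 * s * p + 2 * t) (s * p + suc t)
      ≈⟨ +-cong (lucas (2 * s) (2 * t) s t 2t<p t<p) (neg-cong (lucas (2 * s) (2 * t) s (suc t) 2t<p (t+1<p t 3t<2p))) ⟩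
    + B (2 * s) s Z.* + B (2 * t) t Z.- + B (2 * s) s Z.* + B (2 * t) (suc t)
      ≡⟨ factor (+ B (2 * s) s) _ _ ⟩
    + B (2 * s) s Z.* Cat t ∎
    where
    open ≈-Reasoning
    k = s * p + t
    3t<2p = ℕP.<-≤-trans 3t<p (ℕP.m≤m+n p p)
    t<p = ℕP.≤-<-trans (ℕP.m≤m+n t (t + (t + 0))) 3t<p
    2t<p = ℕP.≤-<-trans (ℕP.*-monoˡ-≤ t (ℕP.n≤1+n 2)) 3t<p
    factor : ∀ b x y → b Z.* x Z.- b Z.* y ≡ b Z.* (x Z.- y)
    factor = solve-∀

  C3-digits : ∀ s t → 3 * t < p → + B (3 * (s * p + t)) (s * p + t) ≈ + B (3 * s) s Z.* + B (3 * t) t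
  C3-digits s t 3t<p = ≈-trans (≈-reflexive (cong (λ x → + B x (s * p + t)) (scale-digits 3 s t)))
                               (lucas (3 * s) (3 * t) s t 3t<p (ℕP.≤-<-trans (ℕP.m≤m+n t (t + (t + 0))) 3t<p))

  CM-digits : ∀ s t → 3 * t < p → + B M (3 * (s * p + t)) ≈ + B n′ (3 * s) Z.* + B q (3 * t)
  CM-digits s t 3t<p = ≈-trans (≈-reflexive (cong₂ (λ x y → + B x y) M-digits (scale-digits 3 s t)))
                               (lucas n′ q (3 * s) (3 * t) (ℕP.n<1+n q) 3t<p)

  CNk-digits : ∀ s t → t < p → + B (N + (s * p + t)) (s * p + t) ≈ + B (n + s) s
  CNk-digits s t t<p = begin
    + B (N + (s * p + t)) (s * p + t)   ≡⟨ cong (λ x → + B x (s * p + t)) (N+k-digits s t) ⟩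
    + B ((n + s) * p + t) (s * p + t)   ≈⟨ lucas (n + s) t s t t<p t<p ⟩
    + B (n + s) s Z.* + B t t           ≡⟨ trans (cong (λ x → + B (n + s) s Z.* + x) (B-diag t)) (ZP.*-identityʳ _) ⟩
    + B (n + s) s                       ∎
    where open ≈-Reasoning

  power-digits : ∀ s t → 3 * s < n → 3 * t < p → 3 ^ (N ∸ (3 * (s * p + t) + 1)) ≡ (3 ^ p) ^ (n′ ∸ 3 * s) * 3 ^ (q ∸ 3 * t)
  power-digits s t 3s<n 3t<p = begin
    3 ^ (N ∸ (3 * (s * p + t) + 1))     ≡⟨ cong (3 ^_) exponent ⟩
    3 ^ (p * e + f)                     ≡⟨ ℕP.^-distribˡ-+-* 3 (p * e) f ⟩
    3 ^ (p * e) * 3 ^ f                 ≡⟨ cong (_* 3 ^ f) (ℕP.^-*-assoc 3 p e) ⟨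
    (3 ^ p) ^ e * 3 ^ f                 ∎
    where
    open ≡-Reasoning
    e = n′ ∸ 3 * s
    f = q ∸ 3 * t
    split : ∀ s t e f → suc (3 * t + f) * suc (3 * s + e) ≡ (3 * (s * suc (3 * t + f) + t) + 1) + (suc (3 * t + f) * e + f)
    split = ℕSolver.solve-∀
    N-split : N ≡ (3 * (s * p + t) + 1) + (p * e + f)
    N-split = subst₂ (λ x y → suc x * suc y ≡ (3 * (s * suc x + t) + 1) + (suc x * e + f))
                     (ℕP.m+[n∸m]≡n (ℕP.≤-pred 3t<p)) (ℕP.m+[n∸m]≡n (ℕP.≤-pred 3s<n)) (split s t e f)
    exponent : N ∸ (3 * (s * p + t) + 1) ≡ p * e + f
    exponent = trans (cong (_∸ (3 * (s * p + t) + 1)) N-split) (ℕP.m+n∸m≡n (3 * (s * p + t) + 1) (p * e + f))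

  reduced-digits : ∀ s t → 3 * s < n → 3 * t < p → reduced (s * p + t) ≈ high-term s Z.* digit-term t
  reduced-digits s t 3s<n 3t<p = begin
    sign (N ∸ k) Z.* (Cat k Z.* + (b3 * bM * bN * 3 ^ (N ∸ (3 * k + 1))))
      ≡⟨ cong (λ z → sign (N ∸ k) Z.* (Cat k Z.* z)) (trans (cong (λ x → + (b3 * bM * bN * x)) (power-digits s t 3s<n 3t<p)) (pos-*⁴ b3 bM bN (E₁ * E₂))) ⟩
    sign (N ∸ k) Z.* (Cat k Z.* (+ b3 Z.* + bM Z.* + bN Z.* + (E₁ * E₂)))
      ≈⟨ *-cong (≈-reflexive (sign-digits s t s<n t<p))
                (*-cong (Cat-digits s t 3t<p) (*-cong (*-cong (*-cong (C3-digits s t 3t<p) (CM-digits s t 3t<p)) (CNk-digits s t t<p)) (≈-reflexive (ZP.pos-* E₁ E₂)))) ⟩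
    (sign (n ∸ s) Z.* sign t) Z.* ((+ B (2 * s) s Z.* Cat t) Z.* ((+ B3s Z.* + B3t) Z.* (+ Bn Z.* + Bq) Z.* + Bns Z.* (+ E₁ Z.* + E₂)))
      ≡⟨ separate (sign (n ∸ s)) (sign t) (+ B (2 * s) s) (Cat t) (+ B3s) (+ B3t) (+ Bn) (+ Bq) (+ Bns) (+ E₁) (+ E₂) ⟩
    (sign (n ∸ s) Z.* (+ B (2 * s) s Z.* (+ B3s Z.* + Bn Z.* + Bns Z.* + E₁))) Z.* (sign t Z.* (Cat t Z.* (+ B3t Z.* + Bq Z.* + E₂)))
      ≡⟨ cong₂ (λ u v → (sign (n ∸ s) Z.* (+ B (2 * s) s Z.* u)) Z.* (sign t Z.* (Cat t Z.* v))) (sym (pos-*⁴ B3s Bn Bns E₁)) (sym pos-*³) ⟩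
    high-term s Z.* digit-term t ∎
    where
    open ≈-Reasoning
    k = s * p + t
    b3 = B (3 * k) k
    bM = B M (3 * k)
    bN = B (N + k) k
    E₁ = (3 ^ p) ^ (n′ ∸ 3 * s)
    E₂ = 3 ^ (q ∸ 3 * t)
    B3s = B (3 * s) s
    B3t = B (3 * t) t
    Bn = B n′ (3 * s)
    Bq = B q (3 * t)
    Bns = B (n + s) s
    t<p = ℕP.≤-<-trans (ℕP.m≤m+n t (t + (t + 0))) 3t<p
    s<n = ℕP.≤-<-trans (ℕP.m≤m+n s (s + (s + 0))) 3s<n
    pos-*³ : + (B3t * Bq * E₂) ≡ + B3t Z.* + Bq Z.* + E₂
    pos-*³ = trans (ZP.pos-* (B3t * Bq) E₂) (cong (Z._* + E₂) (ZP.pos-* B3t Bq))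
    separate : ∀ σ τ b₂ c b₃ b₃′ b b′ b″ e e′ →
      (σ Z.* τ) Z.* ((b₂ Z.* c) Z.* ((b₃ Z.* b₃′) Z.* (b Z.* b′) Z.* b″ Z.* (e Z.* e′)))
      ≡ (σ Z.* (b₂ Z.* (b₃ Z.* b Z.* b″ Z.* e))) Z.* (τ Z.* (c Z.* (b₃′ Z.* b′ Z.* e′)))
    separate = solve-∀

  private
    reduced≈0-by-C3 : ∀ k → + B (3 * k) k ≈ 0ℤ → reduced k ≈ 0ℤ
    reduced≈0-by-C3 k C3≈0 = begin
      sign (N ∸ k) Z.* (Cat k Z.* + (B (3 * k) k * bM * bN * e))          ≡⟨ cong (λ z → sign (N ∸ k) Z.* (Cat k Z.* z)) (pos-*⁴ (B (3 * k) k) bM bN e) ⟩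
      sign (N ∸ k) Z.* (Cat k Z.* (+ B (3 * k) k Z.* + bM Z.* + bN Z.* + e)) ≈⟨ *-congˡ (sign (N ∸ k)) (*-congˡ (Cat k) (*-congʳ (+ e) (*-congʳ (+ bN) (*-congʳ (+ bM) C3≈0)))) ⟩
      sign (N ∸ k) Z.* (Cat k Z.* (0ℤ Z.* + bM Z.* + bN Z.* + e))           ≡⟨ annihilate (sign (N ∸ k)) (Cat k) (+ bM) (+ bN) (+ e) ⟩
      0ℤ                                                                   ∎
      where
      open ≈-Reasoning
      bM = B M (3 * k)
      bN = B (N + k) k
      e = 3 ^ (N ∸ (3 * k + 1))
      annihilate : ∀ σ c x y z → σ Z.* (c Z.* (0ℤ Z.* x Z.* y Z.* z)) ≡ 0ℤ
      annihilate = solve-∀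

    reduced≈0-by-Cat : ∀ k → Cat k ≈ 0ℤ → reduced k ≈ 0ℤ
    reduced≈0-by-Cat k Cat≈0 = begin
      sign (N ∸ k) Z.* (Cat k Z.* x)   ≈⟨ *-congˡ (sign (N ∸ k)) (*-congʳ x Cat≈0) ⟩
      sign (N ∸ k) Z.* (0ℤ Z.* x)      ≡⟨ annihilate (sign (N ∸ k)) x ⟩
      0ℤ                               ∎
      where
      open ≈-Reasoning
      x = + (B (3 * k) k * B M (3 * k) * B (N + k) k * 3 ^ (N ∸ (3 * k + 1)))
      annihilate : ∀ σ x → σ Z.* (0ℤ Z.* x) ≡ 0ℤ
      annihilate = solve-∀

    carry : ∀ x j r s t d → j * p + r ≡ x * t → r < d → d < p → + B (x * (s * p + t)) (s * p + d) ≈ 0ℤ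
    carry x j r s t d xt≡ r<d d<p = ≈-trans (≈-reflexive (cong (λ y → + B y (s * p + d)) top-digits)) (lucas-carry (x * s + j) r s d r<d d<p)
      where
      regroup : ∀ x s j p r → x * s * p + (j * p + r) ≡ (x * s + j) * p + r
      regroup = ℕSolver.solve-∀
      top-digits : x * (s * p + t) ≡ (x * s + j) * p + r
      top-digits = trans (scale-digits x s t) (trans (cong (_+_ (x * s * p)) (sym xt≡)) (regroup x s j p r))

    low-digit< : ∀ x j t → j * p ≤ x * t → x * t < j * p + t → x * t ∸ j * p < t
    low-digit< x j t jp≤xt xt<jp+t = ℕP.+-cancelˡ-< (j * p) (x * t ∸ j * p) t (subst (_< j * p + t) (sym (ℕP.m+[n∸m]≡n jp≤xt)) xt<jp+t)

  -- For a low digit t with 3t ≥ p the reduced summand vanishes: there is a carry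
  -- in 3k = 3(s·p + t) or in 2k.
  reduced-carry : ∀ s t → t < p → p ≤ 3 * t → reduced (s * p + t) ≈ 0ℤ
  reduced-carry s t t<p p≤3t with 3 * t ℕ.<? 2 * p | 2 * t ℕ.<? p
  ... | no 3t≮2p | _ = reduced≈0-by-C3 k (carry 3 2 r s t t (ℕP.m+[n∸m]≡n 2p≤3t) (low-digit< 3 2 t 2p≤3t 3t<2p+t) t<p)
    where
    k = s * p + t
    2p≤3t = ℕP.≮⇒≥ 3t≮2p
    r = 3 * t ∸ 2 * p
    3t<2p+t : 3 * t < 2 * p + t
    3t<2p+t = subst₂ _<_ (thrice t) refl (ℕP.+-monoˡ-< t (ℕP.*-monoʳ-< 2 t<p))
      where thrice : ∀ t → 2 * t + t ≡ 3 * t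
            thrice = ℕSolver.solve-∀
  ... | yes _ | yes 2t<p = reduced≈0-by-C3 k (carry 3 1 r s t t (ℕP.m+[n∸m]≡n 1p≤3t) (low-digit< 3 1 t 1p≤3t 3t<p+t) t<p)
    where
    k = s * p + t
    1p≤3t = ℕP.≤-trans (ℕP.≤-reflexive (ℕP.*-identityˡ p)) p≤3t
    r = 3 * t ∸ 1 * p
    3t<p+t : 3 * t < 1 * p + t
    3t<p+t = subst₂ _<_ (thrice t) (cong (_+ t) (sym (ℕP.*-identityˡ p))) (ℕP.+-monoˡ-< t 2t<p)
      where thrice : ∀ t → 2 * t + t ≡ 3 * t
            thrice = ℕSolver.solve-∀
  ... | yes 3t<2p | no 2t≮p = reduced≈0-by-Cat k (begin
    + B (2 * k) k Z.- + B (2 * k) (suc k)              ≡⟨ cong (λ y → + B (2 * k) k Z.- + B (2 * k) y) (sym (ℕP.+-suc (s * p) t)) ⟩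
    + B (2 * k) k Z.- + B (2 * k) (s * p + suc t)      ≈⟨ +-cong (carry 2 1 r s t t 2t≡ r<t t<p) (neg-cong (carry 2 1 r s t (suc t) 2t≡ (ℕP.m<n⇒m<1+n r<t) (t+1<p t 3t<p+p))) ⟩
    0ℤ Z.- 0ℤ                                          ≡⟨⟩
    0ℤ                                                 ∎)
    where
    open ≈-Reasoning
    k = s * p + t
    1p≤2t = ℕP.≤-trans (ℕP.≤-reflexive (ℕP.*-identityˡ p)) (ℕP.≮⇒≥ 2t≮p)
    r = 2 * t ∸ 1 * p
    2t≡ = ℕP.m+[n∸m]≡n 1p≤2t
    r<t : r < t
    r<t = low-digit< 2 1 t 1p≤2t (subst₂ _<_ (twice t) (cong (_+ t) (sym (ℕP.*-identityˡ p))) (ℕP.+-monoˡ-< t t<p))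
      where twice : ∀ t → t + t ≡ 2 * t
            twice = ℕSolver.solve-∀
    3t<p+p = subst (3 * t <_) (cong (_+_ p) (ℕP.+-identityʳ p)) 3t<2p

  -- A high digit s with 3s ≥ n kills both sides (C(N-1, 3k) = 0 = C(n-1, 3s)).
  high-term-vanishes : ∀ s → n ≤ 3 * s → high-term s ≡ 0ℤ
  high-term-vanishes s n≤3s = begin
    sign (n ∸ s) Z.* (+ B (2 * s) s Z.* + (B3 * B n′ (3 * s) * c * e))   ≡⟨ cong (λ z → sign (n ∸ s) Z.* (+ B (2 * s) s Z.* + (B3 * z * c * e))) (B-above n′ (3 * s) n≤3s) ⟩
    sign (n ∸ s) Z.* (+ B (2 * s) s Z.* + (B3 * 0 * c * e))              ≡⟨ cong (λ z → sign (n ∸ s) Z.* (+ B (2 * s) s Z.* + (z * c * e))) (ℕP.*-zeroʳ B3) ⟩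
    sign (n ∸ s) Z.* (+ B (2 * s) s Z.* 0ℤ)                               ≡⟨ cong (sign (n ∸ s) Z.*_) (ZP.*-zeroʳ (+ B (2 * s) s)) ⟩
    sign (n ∸ s) Z.* 0ℤ                                                   ≡⟨ ZP.*-zeroʳ (sign (n ∸ s)) ⟩
    0ℤ                                                                    ∎
    where
    open ≡-Reasoning
    B3 = B (3 * s) s
    c = B (n + s) s
    e = (3 ^ p) ^ (n′ ∸ 3 * s)

  N≤3k : ∀ s t → n ≤ 3 * s → N ≤ 3 * (s * p + t)
  N≤3k s t n≤3s = begin
    N                      ≡⟨ ℕP.*-comm p n ⟩
    n * p                  ≤⟨ ℕP.*-monoˡ-≤ p n≤3s ⟩
    3 * s * p              ≤⟨ ℕP.m≤m+n (3 * s * p) (3 * t) ⟩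
    3 * s * p + 3 * t      ≡⟨ scale-digits 3 s t ⟨
    3 * (s * p + t)        ∎
    where open ℕP.≤-Reasoning

  decompose : ∀ s t → t < p → reduced (s * p + t) ≈ high-term s Z.* low-term t
  decompose s t t<p with 3 * t ℕ.<? p | 3 * s ℕ.<? n
  ... | no 3t≮p | _ = ≈-trans (reduced-carry s t t<p (ℕP.≮⇒≥ 3t≮p)) (≈-reflexive (sym (ZP.*-zeroʳ (high-term s))))
  ... | yes 3t<p | yes 3s<n = reduced-digits s t 3s<n 3t<p
  ... | yes 3t<p | no 3s≮n = ≈-reflexive (begin
    reduced (s * p + t)              ≡⟨ reduced-vanishes (s * p + t) (N≤3k s t (ℕP.≮⇒≥ 3s≮n)) ⟩
    0ℤ                               ≡⟨ ZP.*-zeroˡ (digit-term t) ⟨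
    0ℤ Z.* digit-term t              ≡⟨ cong (Z._* digit-term t) (high-term-vanishes s (ℕP.≮⇒≥ 3s≮n)) ⟨
    high-term s Z.* digit-term t     ∎)
    where open ≡-Reasoning

  reduced-sum≈0 : Σ< (n * p) reduced ≈ 0ℤ
  reduced-sum≈0 = begin
    Σ< (n * p) reduced                                        ≡⟨ Σ<-blocks n p reduced ⟩
    Σ< n (λ s → Σ< p (λ t → reduced (s * p + t)))             ≈⟨ Σ<-≈ n (λ s → Σ<-≈< p (λ t t<p → decompose s t t<p)) ⟩
    Σ< n (λ s → Σ< p (λ t → high-term s Z.* low-term t))      ≡⟨ Σ<-cong n (λ s → Σ<-*ˡ p (high-term s) low-term) ⟩
    Σ< n (λ s → high-term s Z.* Σ< p low-term)                ≈⟨ Σ<-≈ n (λ s → *-congˡ (high-term s) (central-sum 4≤q)) ⟩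
    Σ< n (λ s → high-term s Z.* 0ℤ)                           ≡⟨ Σ<-zero n (λ s → ZP.*-zeroʳ (high-term s)) ⟩
    0ℤ                                                        ∎
    where open ≈-Reasoning

open import Data.Nat using (_*_; _^_)
open import Data.Integer.Divisibility using (_∣_)
open import Data.Integer.Divisibility.Signed using (divides; ∣⇒∣ᵤ)

p²∣ : ∀ p n {X S} → X ≡ + (p * n) Z.* S → Congruence._≈_ (+ p) S 0ℤ → + (p ^ 2) ∣ X
p²∣ p n {X} {S} X≡ (Congruence.mk (divides r S-0≡)) = ∣⇒∣ᵤ (divides (r Z.* + n) (begin
  X                                   ≡⟨ X≡ ⟩
  + (p * n) Z.* S                     ≡⟨ cong₂ Z._*_ (ZP.pos-* p n) (trans (sym (ZP.+-identityʳ S)) S-0≡) ⟩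
  + p Z.* + n Z.* (r Z.* + p)         ≡⟨ regroup (+ p) (+ n) r ⟩
  r Z.* + n Z.* (+ p Z.* (+ p Z.* + 1)) ≡⟨ cong (r Z.* + n Z.*_) (trans (ZP.pos-* p (p * 1)) (cong (+ p Z.*_) (ZP.pos-* p 1))) ⟨
  r Z.* + n Z.* + (p ^ 2)             ∎))
  where
  open ≡-Reasoning
  regroup : ∀ p n r → p Z.* n Z.* (r Z.* p) ≡ r Z.* n Z.* (p Z.* (p Z.* Z.+ 1))
  regroup = solve-∀

theorem3p1 : (p n : ℕ) → Prime p → 5 ≤ p → 1 ≤ n → + (p ^ 2) ∣ a₁ (p * n)
theorem3p1 (suc q) (suc n′) isPrime (s≤s 4≤q) (s≤s z≤n) =
  p²∣ (suc q) (suc n′) (a₁-factor (n * suc q) (ℕP.≤-reflexive (ℕP.*-comm (suc q) n))) reduced-sum≈0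
  where open Decomposition q isPrime 4≤q n′
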